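{- Let $A$ be a formula of $\mathcal{L}^\omega_*$ with free variables $\underline{a}$, and let $T_{\not\exists}$ be a set of $\exists$-free formulas. If $$\mathrm{IL}^{\omega}_*+\mathrm{AC}^{\omega}_*+\mathrm{IP}^*_{\not\exists}+T_{\not\exists}\vdash A(\underline{a}),$$ then there exist closed terms $\underline{t}$ such that $$\mathrm{IL}^{\omega}_*+T_{\not\exists}\vdash A_{HR}(\underline{a},\underline{t}\underline{a}),$$ where $A^{HR}\equiv\exists\underline{x}\,A_{HR}(\underline{a},\underline{x})$.
   Context: Fix a first-order language $\mathcal{L}$ with at least one constant symbol. Types: $G$; $\sigma\to\tau$; $\sigma^*$. Constants: function symbols of $\mathcal{L}$ (type $G\to\cdots\to G$); $\Pi_{\sigma,\tau}:\sigma\to\tau\to\sigma$; $\Sigma_{\rho,\sigma,\tau}:(\rho\to\sigma\to\tau)\to(\rho\to\sigma)\to\rho\to\tau$; $\mathfrak{s}_\sigma:\sigma\to\sigma^*$; $\cup_\sigma:\sigma^*\to\sigma^*\to\sigma^*$; $\bigcup_{\sigma,\tau}:\sigma^*\to(\sigma\to\tau^*)\to\tau^*$. Terms: constants, typed variables, applications. Atomic formulas: $\bot$, $t=_\rho q$, $t\in_\rho q$ ($q:\rho^*$), $R(t_1,\dots,t_n)$ with $R$ a relation symbol of $\mathcal{L}$. Formulas of $\mathcal{L}^\omega_*$: closed under $\lor,\land,\to,\forall x,\exists x$ and bounded quantifiers $\forall x\in t,\exists x\in t$ ($t:\rho^*$ not containing $x:\rho$). A formula is $\exists$-free if it contains no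 unbounded $\exists x$. $\mathrm{IL}^{\omega}_*$ is intuitionistic predicate logic in all finite types with: $x=x$; $x=y\land A\to A'$ for atomic $A$ ($A'$ replacing some $x$ by $y$); $\forall x\in t\,A\leftrightarrow\forall x(x\in t\to A)$; $\exists x\in t\,A\leftrightarrow\exists x(x\in t\land A)$; $\Sigma xyz=xz(yz)$; $\Pi xy=x$; $w\in\mathfrak{s}x\leftrightarrow w=x$; $w\in\cup xy\leftrightarrow w\in x\lor w\in y$; $z\in x\land w\in yz\to w\in\bigcup xy$; $\bigcup(\mathfrak{s}x)y=yx$; $\bigcup(\cup xy)z=\cup(\bigcup xz)(\bigcup yz)$. $\mathrm{AC}^{\omega}_*$ is the scheme $\forall x^\rho\exists y^\sigma A(x,y)\to\exists f^{\rho\to\sigma^*}\forall x\exists y\in fx\,A(x,y)$; $\mathrm{IP}^*_{\not\exists}$ is the scheme $(B(x)\to\exists y\,A(y))\to\exists w(B(x)\to\exists y\in w\,A(y))$ for $\exists$-free $B$. The herbrandized modified realizability assigns to each formula $A$ a formula $A^{HR}\equiv\exists\underline{x}\,A_{HR}(\underline{x})$ with the same free variables and $A_{HR}$ $\exists$-free: for atomic $A$, $A^{HR}:\equiv A_{HR}:\equiv A$; if $A^{HR}\equiv\exists\underline{x}A_{HR}(\underline{x})$, $B^{HR}\equiv\exists\underline{u}B_{HR}(\underline{u})$: $(A\lor B)^{HR}:\equiv\exists\underline{x},\underline{u}(A_{HR}(\underline{x})\lor B_{HR}(\underline{u}))$; $(A\land B)^{HR}:\equiv\exists\underline{x},\underline{u}(A_{HR}(\underline{x})\land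 B_{HR}(\underline{u}))$; $(A\to B)^{HR}:\equiv\exists\underline{U}\forall\underline{x}(A_{HR}(\underline{x})\to B_{HR}(\underline{U}\underline{x}))$; $(\exists zA(z))^{HR}:\equiv\exists Z,\underline{x}\,\exists z\in Z\,A_{HR}(z,\underline{x})$; $(\forall zA(z))^{HR}:\equiv\exists\underline{X}\forall z\,A_{HR}(z,\underline{X}z)$; $(\exists z\in t\,A(z))^{HR}:\equiv\exists\underline{x}\exists z\in t\,A_{HR}(z,\underline{x})$; $(\forall z\in t\,A(z))^{HR}:\equiv\exists\underline{x}\forall z\in t\,A_{HR}(z,\underline{x})$. $\underline{U}\underline{x}$, $\underline{t}\underline{a}$ denote tuples of applications of each component to all listed arguments. -}

module Defs where

open import Data.Nat using (ℕ)
open import Data.List using (List; []; _∷_; _++_; map; replicate)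
open import Data.List.Membership.Propositional using (_∈_)
open import Data.Vec using (Vec)
import Data.Vec as Vec
open import Data.Sum using (_⊎_; inj₁; inj₂)
open import Data.Product using (Σ; _×_)
open import Relation.Binary.PropositionalEquality using (_≡_)

record Language : Set₁ where
  field
    Fun      : Set
    farity   : Fun → ℕ
    Rel      : Set
    rarity   : Rel → ℕ
    c₀       : Fun
    c₀-const : farity c₀ ≡ 0

infixr 5 _⇒_
infix 10 _*

data Ty : Set where
  G   : Ty
  _⇒_ : Ty → Ty → Ty
  _*  : Ty → Ty

arrows : List Ty → Ty → Ty
arrows []       τ = τ
arrows (σ ∷ xs) τ = σ ⇒ arrows xs τ

-- Typed de Bruijn variables (head of the context = most recently bound)
data Var : List Ty → Ty → Set where
  here  : ∀ {Γ σ} → Var (σ ∷ Γ) σ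
  there : ∀ {Γ σ τ} → Var Γ σ → Var (τ ∷ Γ) σ

Ren : List Ty → List Ty → Set
Ren Γ Δ = ∀ {σ} → Var Γ σ → Var Δ σ

liftR : ∀ {Γ Δ σ} → Ren Γ Δ → Ren (σ ∷ Γ) (σ ∷ Δ)
liftR r here      = here
liftR r (there v) = there (r v)

inl : ∀ {Γ σ} (xs : List Ty) → Var xs σ → Var (xs ++ Γ) σ
inl (_ ∷ xs) here      = here
inl (_ ∷ xs) (there v) = there (inl xs v)

inr : ∀ {Γ σ} (xs : List Ty) → Var Γ σ → Var (xs ++ Γ) σ
inr []       v = v
inr (_ ∷ xs) v = there (inr xs v)

split : ∀ {Γ σ} (xs : List Ty) → Var (xs ++ Γ) σ → Var xs σ ⊎ Var Γ σ
split []       v         = inj₂ v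
split (_ ∷ xs) here      = inj₁ here
split (_ ∷ xs) (there v) with split xs v
... | inj₁ w = inj₁ (there w)
... | inj₂ w = inj₂ w

mapVar : ∀ {xs σ} (f : Ty → Ty) → Var xs σ → Var (map f xs) (f σ)
mapVar f here      = here
mapVar f (there v) = there (mapVar f v)

module Syntax (L : Language) where
  open Language L

  data Const : Ty → Set where
    fun    : (f : Fun) → Const (arrows (replicate (farity f) G) G)
    Πc     : ∀ σ τ → Const (σ ⇒ τ ⇒ σ)
    Σc     : ∀ ρ σ τ → Const ((ρ ⇒ σ ⇒ τ) ⇒ (ρ ⇒ σ) ⇒ ρ ⇒ τ)
    sng    : ∀ σ → Const (σ ⇒ σ *)
    cup    : ∀ σ → Const (σ * ⇒ σ * ⇒ σ *)
    bigcup : ∀ σ τ → Const (σ * ⇒ (σ ⇒ τ *) ⇒ τ *)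

  data Term (Γ : List Ty) : Ty → Set where
    var : ∀ {σ} → Var Γ σ → Term Γ σ
    con : ∀ {σ} → Const σ → Term Γ σ
    app : ∀ {σ τ} → Term Γ (σ ⇒ τ) → Term Γ σ → Term Γ τ

  data Form (Γ : List Ty) : Set where
    ⊥'   : Form Γ
    eq   : ∀ {ρ} → Term Γ ρ → Term Γ ρ → Form Γ
    mem  : ∀ {ρ} → Term Γ ρ → Term Γ (ρ *) → Form Γ
    rel  : (R : Rel) → Vec (Term Γ G) (rarity R) → Form Γ
    or   : Form Γ → Form Γ → Form Γ
    and  : Form Γ → Form Γ → Form Γ
    imp  : Form Γ → Form Γ → Form Γ
    all  : (σ : Ty) → Form (σ ∷ Γ) → Form Γ
    ex   : (σ : Ty) → Form (σ ∷ Γ) → Form Γ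
    ball : (σ : Ty) → Term Γ (σ *) → Form (σ ∷ Γ) → Form Γ
    bex  : (σ : Ty) → Term Γ (σ *) → Form (σ ∷ Γ) → Form Γ

  renT : ∀ {Γ Δ σ} → Ren Γ Δ → Term Γ σ → Term Δ σ
  renT r (var v)   = var (r v)
  renT r (con c)   = con c
  renT r (app t u) = app (renT r t) (renT r u)

  renF : ∀ {Γ Δ} → Ren Γ Δ → Form Γ → Form Δ
  renF r ⊥'           = ⊥'
  renF r (eq t u)     = eq (renT r t) (renT r u)
  renF r (mem t u)    = mem (renT r t) (renT r u)
  renF r (rel R ts)   = rel R (Vec.map (renT r) ts)
  renF r (or A B)     = or (renF r A) (renF r B)
  renF r (and A B)    = and (renF r A) (renF r B)
  renF r (imp A B)    = imp (renF r A) (renF r B)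
  renF r (all σ A)    = all σ (renF (liftR r) A)
  renF r (ex σ A)     = ex σ (renF (liftR r) A)
  renF r (ball σ t A) = ball σ (renT r t) (renF (liftR r) A)
  renF r (bex σ t A)  = bex σ (renT r t) (renF (liftR r) A)

  wkT : ∀ {Γ σ τ} → Term Γ σ → Term (τ ∷ Γ) σ
  wkT = renT there

  wkF : ∀ {Γ τ} → Form Γ → Form (τ ∷ Γ)
  wkF = renF there

  Subst : List Ty → List Ty → Set
  Subst Γ Δ = ∀ {σ} → Var Γ σ → Term Δ σ

  liftS : ∀ {Γ Δ σ} → Subst Γ Δ → Subst (σ ∷ Γ) (σ ∷ Δ)
  liftS s here      = var here
  liftS s (there v) = wkT (s v)

  subT : ∀ {Γ Δ σ} → Subst Γ Δ → Term Γ σ → Term Δ σ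
  subT s (var v)   = s v
  subT s (con c)   = con c
  subT s (app t u) = app (subT s t) (subT s u)

  subF : ∀ {Γ Δ} → Subst Γ Δ → Form Γ → Form Δ
  subF s ⊥'           = ⊥'
  subF s (eq t u)     = eq (subT s t) (subT s u)
  subF s (mem t u)    = mem (subT s t) (subT s u)
  subF s (rel R ts)   = rel R (Vec.map (subT s) ts)
  subF s (or A B)     = or (subF s A) (subF s B)
  subF s (and A B)    = and (subF s A) (subF s B)
  subF s (imp A B)    = imp (subF s A) (subF s B)
  subF s (all σ A)    = all σ (subF (liftS s) A)
  subF s (ex σ A)     = ex σ (subF (liftS s) A)
  subF s (ball σ t A) = ball σ (subT s t) (subF (liftS s) A)
  subF s (bex σ t A)  = bex σ (subT s t) (subF (liftS s) A)

  sub1 : ∀ {Γ σ} → Term Γ σ → Subst (σ ∷ Γ) Γ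
  sub1 t here      = t
  sub1 t (there v) = var v

  _[_] : ∀ {Γ σ} → Form (σ ∷ Γ) → Term Γ σ → Form Γ
  A [ t ] = subF (sub1 t) A

  applyAll : ∀ {Δ τ} (xs : List Ty) → Term Δ (arrows xs τ)
           → (∀ {σ} → Var xs σ → Term Δ σ) → Term Δ τ
  applyAll []       t args = t
  applyAll (σ ∷ xs) t args = applyAll xs (app t (args here)) (λ v → args (there v))

  allN : ∀ {Γ} (xs : List Ty) → Form (xs ++ Γ) → Form Γ
  allN []       A = A
  allN (σ ∷ xs) A = allN xs (all σ A)

  data Atomic {Γ} : Form Γ → Set where
    at-⊥   : Atomic ⊥'
    at-eq  : ∀ {ρ} (t u : Term Γ ρ) → Atomic (eq t u)
    at-mem : ∀ {ρ} (t : Term Γ ρ) (u : Term Γ (ρ *)) → Atomic (mem t u)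
    at-rel : ∀ R ts → Atomic (rel R ts)

  data ExFree : ∀ {Γ} → Form Γ → Set where
    ef-at   : ∀ {Γ} {A : Form Γ} → Atomic A → ExFree A
    ef-or   : ∀ {Γ} {A B : Form Γ} → ExFree A → ExFree B → ExFree (or A B)
    ef-and  : ∀ {Γ} {A B : Form Γ} → ExFree A → ExFree B → ExFree (and A B)
    ef-imp  : ∀ {Γ} {A B : Form Γ} → ExFree A → ExFree B → ExFree (imp A B)
    ef-all  : ∀ {Γ σ} {A : Form (σ ∷ Γ)} → ExFree A → ExFree (all σ A)
    ef-ball : ∀ {Γ σ t} {A : Form (σ ∷ Γ)} → ExFree A → ExFree (ball σ t A)
    ef-bex  : ∀ {Γ σ t} {A : Form (σ ∷ Γ)} → ExFree A → ExFree (bex σ t A)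

  Axioms : Set₁
  Axioms = ∀ {Γ} → Form Γ → Set

  _∪A_ : Axioms → Axioms → Axioms
  (P ∪A Q) A = P A ⊎ Q A

  data ILAx : Axioms where
    eq-refl   : ∀ {Γ ρ} (x : Term Γ ρ) → ILAx (eq x x)
    -- x = y ∧ A → A' (A atomic; the hole z marks the replaced occurrences)
    eq-subst  : ∀ {Γ ρ} (A : Form (ρ ∷ Γ)) → Atomic A → (x y : Term Γ ρ)
              → ILAx (imp (and (eq x y) (A [ x ])) (A [ y ]))
    ball-def₁ : ∀ {Γ σ} (t : Term Γ (σ *)) (A : Form (σ ∷ Γ))
              → ILAx (imp (ball σ t A) (all σ (imp (mem (var here) (wkT t)) A)))
    ball-def₂ : ∀ {Γ σ} (t : Term Γ (σ *)) (A : Form (σ ∷ Γ))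
              → ILAx (imp (all σ (imp (mem (var here) (wkT t)) A)) (ball σ t A))
    bex-def₁  : ∀ {Γ σ} (t : Term Γ (σ *)) (A : Form (σ ∷ Γ))
              → ILAx (imp (bex σ t A) (ex σ (and (mem (var here) (wkT t)) A)))
    bex-def₂  : ∀ {Γ σ} (t : Term Γ (σ *)) (A : Form (σ ∷ Γ))
              → ILAx (imp (ex σ (and (mem (var here) (wkT t)) A)) (bex σ t A))
    Σ-ax      : ∀ {Γ ρ σ τ} (x : Term Γ (ρ ⇒ σ ⇒ τ)) (y : Term Γ (ρ ⇒ σ)) (z : Term Γ ρ)
              → ILAx (eq (app (app (app (con (Σc ρ σ τ)) x) y) z) (app (app x z) (app y z)))
    Π-ax      : ∀ {Γ σ τ} (x : Term Γ σ) (y : Term Γ τ)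
              → ILAx (eq (app (app (con (Πc σ τ)) x) y) x)
    sng-ax₁   : ∀ {Γ σ} (w x : Term Γ σ)
              → ILAx (imp (mem w (app (con (sng σ)) x)) (eq w x))
    sng-ax₂   : ∀ {Γ σ} (w x : Term Γ σ)
              → ILAx (imp (eq w x) (mem w (app (con (sng σ)) x)))
    cup-ax₁   : ∀ {Γ σ} (w : Term Γ σ) (x y : Term Γ (σ *))
              → ILAx (imp (mem w (app (app (con (cup σ)) x) y)) (or (mem w x) (mem w y)))
    cup-ax₂   : ∀ {Γ σ} (w : Term Γ σ) (x y : Term Γ (σ *))
              → ILAx (imp (or (mem w x) (mem w y)) (mem w (app (app (con (cup σ)) x) y)))
    bigcup-ax : ∀ {Γ σ τ} (z : Term Γ σ) (x : Term Γ (σ *)) (w : Term Γ τ) (y : Term Γ (σ ⇒ τ *))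
              → ILAx (imp (and (mem z x) (mem w (app y z)))
                          (mem w (app (app (con (bigcup σ τ)) x) y)))
    bigcup-sng : ∀ {Γ σ τ} (x : Term Γ σ) (y : Term Γ (σ ⇒ τ *))
              → ILAx (eq (app (app (con (bigcup σ τ)) (app (con (sng σ)) x)) y) (app y x))
    bigcup-cup : ∀ {Γ σ τ} (x y : Term Γ (σ *)) (z : Term Γ (σ ⇒ τ *))
              → ILAx (eq (app (app (con (bigcup σ τ)) (app (app (con (cup σ)) x) y)) z)
                         (app (app (con (cup τ)) (app (app (con (bigcup σ τ)) x) z))
                                                 (app (app (con (bigcup σ τ)) y) z)))

  -- AC^ω_* : ∀x^ρ ∃y^σ A(x,y) → ∃f^{ρ→σ*} ∀x ∃y∈fx A(x,y)
  data ACAx : Axioms where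
    ac : ∀ {Γ} (ρ σ : Ty) (A : Form (σ ∷ ρ ∷ Γ))
       → ACAx (imp (all ρ (ex σ A))
                   (ex (ρ ⇒ σ *) (all ρ (bex σ (app (var (there here)) (var here))
                                              (renF (liftR (liftR there)) A)))))

  -- IP^*_∄ : (B → ∃y A(y)) → ∃w (B → ∃y∈w A(y)),  B ∃-free
  data IPAx : Axioms where
    ip : ∀ {Γ} (B : Form Γ) → ExFree B → (σ : Ty) (A : Form (σ ∷ Γ))
       → IPAx (imp (imp B (ex σ A))
                   (ex (σ *) (imp (wkF B) (bex σ (var here) (renF (liftR there) A)))))

  -- the axioms of a theory T (a set of formulas), used via substitution instances
  -- (i.e. formulas of T with free variables are read as universally closed)
  TAx : Axioms → Axioms
  TAx T {Γ'} A = Σ (List Ty) λ Γ → Σ (Form Γ) λ B → T B × Σ (Subst Γ Γ') λ s → A ≡ subF s B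

  data Der (Ax : Axioms) : ∀ {Γ} → List (Form Γ) → Form Γ → Set where
    hyp   : ∀ {Γ Δ} {A : Form Γ} → A ∈ Δ → Der Ax Δ A
    ax    : ∀ {Γ Δ} {A : Form Γ} → Ax A → Der Ax Δ A
    ⊥E    : ∀ {Γ Δ} {A : Form Γ} → Der Ax Δ ⊥' → Der Ax Δ A
    ∧I    : ∀ {Γ Δ} {A B : Form Γ} → Der Ax Δ A → Der Ax Δ B → Der Ax Δ (and A B)
    ∧E₁   : ∀ {Γ Δ} {A B : Form Γ} → Der Ax Δ (and A B) → Der Ax Δ A
    ∧E₂   : ∀ {Γ Δ} {A B : Form Γ} → Der Ax Δ (and A B) → Der Ax Δ B
    ∨I₁   : ∀ {Γ Δ} {A B : Form Γ} → Der Ax Δ A → Der Ax Δ (or A B)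
    ∨I₂   : ∀ {Γ Δ} {A B : Form Γ} → Der Ax Δ B → Der Ax Δ (or A B)
    ∨E    : ∀ {Γ Δ} {A B C : Form Γ} → Der Ax Δ (or A B)
          → Der Ax (A ∷ Δ) C → Der Ax (B ∷ Δ) C → Der Ax Δ C
    →I    : ∀ {Γ Δ} {A B : Form Γ} → Der Ax (A ∷ Δ) B → Der Ax Δ (imp A B)
    →E    : ∀ {Γ Δ} {A B : Form Γ} → Der Ax Δ (imp A B) → Der Ax Δ A → Der Ax Δ B
    ∀I    : ∀ {Γ Δ σ} {A : Form (σ ∷ Γ)} → Der Ax (map wkF Δ) A → Der Ax Δ (all σ A)
    ∀E    : ∀ {Γ Δ σ} {A : Form (σ ∷ Γ)} → Der Ax Δ (all σ A) → (t : Term Γ σ) → Der Ax Δ (A [ t ])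
    ∃I    : ∀ {Γ Δ σ} {A : Form (σ ∷ Γ)} (t : Term Γ σ) → Der Ax Δ (A [ t ]) → Der Ax Δ (ex σ A)
    ∃E    : ∀ {Γ Δ σ} {A : Form (σ ∷ Γ)} {C : Form Γ} → Der Ax Δ (ex σ A)
          → Der Ax (A ∷ map wkF Δ) (wkF C) → Der Ax Δ C

  -- Herbrandized modified realizability:  A^HR ≡ ∃ x̲ A_HR(x̲)
  -- W A : types of the witness tuple x̲;  HR A : A_HR, a formula in context W A ++ Γ

  W : ∀ {Γ} → Form Γ → List Ty
  W ⊥'           = []
  W (eq t u)     = []
  W (mem t u)    = []
  W (rel R ts)   = []
  W (or A B)     = W A ++ W B
  W (and A B)    = W A ++ W B
  W (imp A B)    = map (arrows (W A)) (W B)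
  W (all σ A)    = map (σ ⇒_) (W A)
  W (ex σ A)     = σ * ∷ W A
  W (ball σ t A) = W A
  W (bex σ t A)  = W A

  rLeft : ∀ {Γ} (xs ys : List Ty) → Ren (xs ++ Γ) ((xs ++ ys) ++ Γ)
  rLeft xs ys v with split xs v
  ... | inj₁ x = inl (xs ++ ys) (inl xs x)
  ... | inj₂ g = inr (xs ++ ys) g

  rRight : ∀ {Γ} (xs ys : List Ty) → Ren (ys ++ Γ) ((xs ++ ys) ++ Γ)
  rRight xs ys v with split ys v
  ... | inj₁ y = inl (xs ++ ys) (inr xs y)
  ... | inj₂ g = inr (xs ++ ys) g

  rImpA : ∀ {Γ} (xs us : List Ty) → Ren (xs ++ Γ) (xs ++ us ++ Γ)
  rImpA xs us v with split xs v
  ... | inj₁ x = inl xs x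
  ... | inj₂ g = inr xs (inr us g)

  sImpB : ∀ {Γ} (xs ys : List Ty)
        → Subst (ys ++ Γ) (xs ++ map (arrows xs) ys ++ Γ)
  sImpB xs ys v with split ys v
  ... | inj₁ y = applyAll xs (var (inr xs (inl (map (arrows xs) ys) (mapVar (arrows xs) y))))
                            (λ a → var (inl xs a))
  ... | inj₂ g = var (inr xs (inr (map (arrows xs) ys) g))

  rEx : ∀ {Γ σ} (xs : List Ty) → Ren (xs ++ σ ∷ Γ) (σ ∷ σ * ∷ xs ++ Γ)
  rEx xs v with split xs v
  ... | inj₁ x         = there (there (inl xs x))
  ... | inj₂ here      = here
  ... | inj₂ (there g) = there (there (inr xs g))

  sAll : ∀ {Γ σ} (xs : List Ty) → Subst (xs ++ σ ∷ Γ) (σ ∷ map (σ ⇒_) xs ++ Γ)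
  sAll {σ = σ} xs v with split xs v
  ... | inj₁ x         = app (var (there (inl (map (σ ⇒_) xs) (mapVar (σ ⇒_) x)))) (var here)
  ... | inj₂ here      = var here
  ... | inj₂ (there g) = var (there (inr (map (σ ⇒_) xs) g))

  rBd : ∀ {Γ σ} (xs : List Ty) → Ren (xs ++ σ ∷ Γ) (σ ∷ xs ++ Γ)
  rBd xs v with split xs v
  ... | inj₁ x         = there (inl xs x)
  ... | inj₂ here      = here
  ... | inj₂ (there g) = there (inr xs g)

  HR : ∀ {Γ} (A : Form Γ) → Form (W A ++ Γ)
  HR ⊥'           = ⊥'
  HR (eq t u)     = eq t u
  HR (mem t u)    = mem t u
  HR (rel R ts)   = rel R ts
  HR (or A B)     = or  (renF (rLeft (W A) (W B)) (HR A)) (renF (rRight (W A) (W B)) (HR B))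
  HR (and A B)    = and (renF (rLeft (W A) (W B)) (HR A)) (renF (rRight (W A) (W B)) (HR B))
  HR (imp A B)    = allN (W A) (imp (renF (rImpA (W A) (map (arrows (W A)) (W B))) (HR A))
                                    (subF (sImpB (W A) (W B)) (HR B)))
  HR (all σ A)    = all σ (subF (sAll (W A)) (HR A))
  HR (ex σ A)     = bex σ (var here) (renF (rEx (W A)) (HR A))
  HR (ball σ t A) = ball σ (renT (inr (W A)) t) (renF (rBd (W A)) (HR A))
  HR (bex σ t A)  = bex σ (renT (inr (W A)) t) (renF (rBd (W A)) (HR A))

  -- instantiate the witness tuple x̲ by t̲ a̲ (each closed term applied to all
  -- free variables a̲ of Γ, in the order of Γ)
  instW : ∀ {Γ} (xs : List Ty) → (∀ τ → Var xs τ → Term [] (arrows Γ τ)) → Subst (xs ++ Γ) Γ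
  instW {Γ} xs ts v with split xs v
  ... | inj₁ x = applyAll Γ (renT (λ ()) (ts _ x)) var
  ... | inj₂ g = var g

{-# OPTIONS --safe #-}

-- By induction on derivations, a derivation of A from hypotheses Δ yields terms for the witness
-- tuple of A, built from the free variables and the witnesses of Δ, at which IL + T proves the
-- matrix A_HR.  Witnesses are finite sets (all witness types end in a star), and A_HR is monotone
-- under pointwise inclusion; so ∨E, ∃E and ∀x (x ∈ t → A) → ∀x ∈ t A are realized by the union
-- (∪ resp. ⋃) of the candidate witnesses.  Abstraction via Σ and Π handles →I and ∀I, and
-- abstracting the free variables at the end gives closed terms.

module Submission where

open import Defs
open import Data.List using (List; []; _∷_; _++_; map; replicate)
open import Data.List.Properties using (map-cong; map-∘; map-id)
open import Data.List.Membership.Propositional using (_∈_)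
open import Data.List.Membership.Propositional.Properties using (∈-map⁺; ∈-map⁻)
open import Data.List.Relation.Binary.Subset.Propositional using (_⊆_)
open import Data.List.Relation.Binary.Subset.Propositional.Properties using (map⁺; ∷⁺ʳ)
import Data.List.Relation.Unary.Any as Any
open import Data.Product using (Σ; _,_; proj₁; proj₂)
open import Data.Sum using (inj₁; inj₂; [_,_])
open import Data.Unit using (⊤; tt)
open import Data.Empty using (⊥)
import Data.Vec.Properties as Vec
open import Function using (_∘_)
open import Relation.Binary.PropositionalEquality hiding ([_])

module Realizability (L : Language) where
  open Language L
  open Syntax L

  -- Substitution

  infix 4 _≗ˢ_

  _≗ˢ_ : ∀ {Γ Δ} → Subst Γ Δ → Subst Γ Δ → Set
  _≗ˢ_ {Γ} s s' = ∀ {σ} (v : Var Γ σ) → s v ≡ s' v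

  ren : ∀ {Γ Δ} → Ren Γ Δ → Subst Γ Δ
  ren r = var ∘ r

  subT-cong : ∀ {Γ Δ σ} {s s' : Subst Γ Δ} → s ≗ˢ s' → (t : Term Γ σ) → subT s t ≡ subT s' t
  subT-cong e (var v)   = e v
  subT-cong e (con c)   = refl
  subT-cong e (app t u) = cong₂ app (subT-cong e t) (subT-cong e u)

  liftS-cong : ∀ {Γ Δ σ} {s s' : Subst Γ Δ} → s ≗ˢ s' → liftS {σ = σ} s ≗ˢ liftS s'
  liftS-cong e here      = refl
  liftS-cong e (there v) = cong wkT (e v)

  subF-cong : ∀ {Γ Δ} {s s' : Subst Γ Δ} → s ≗ˢ s' → (A : Form Γ) → subF s A ≡ subF s' A
  subF-cong e ⊥'           = refl
  subF-cong e (eq t u)     = cong₂ eq (subT-cong e t) (subT-cong e u)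
  subF-cong e (mem t u)    = cong₂ mem (subT-cong e t) (subT-cong e u)
  subF-cong e (rel R ts)   = cong (rel R) (Vec.map-cong (subT-cong e) ts)
  subF-cong e (or A B)     = cong₂ or (subF-cong e A) (subF-cong e B)
  subF-cong e (and A B)    = cong₂ and (subF-cong e A) (subF-cong e B)
  subF-cong e (imp A B)    = cong₂ imp (subF-cong e A) (subF-cong e B)
  subF-cong e (all σ A)    = cong (all σ) (subF-cong (liftS-cong e) A)
  subF-cong e (ex σ A)     = cong (ex σ) (subF-cong (liftS-cong e) A)
  subF-cong e (ball σ t A) = cong₂ (ball σ) (subT-cong e t) (subF-cong (liftS-cong e) A)
  subF-cong e (bex σ t A)  = cong₂ (bex σ) (subT-cong e t) (subF-cong (liftS-cong e) A)

  renT≡subT : ∀ {Γ Δ σ} (r : Ren Γ Δ) (t : Term Γ σ) → renT r t ≡ subT (ren r) t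
  renT≡subT r (var v)   = refl
  renT≡subT r (con c)   = refl
  renT≡subT r (app t u) = cong₂ app (renT≡subT r t) (renT≡subT r u)

  liftS-ren : ∀ {Γ Δ σ} (r : Ren Γ Δ) → liftS {σ = σ} (ren r) ≗ˢ ren (liftR r)
  liftS-ren r here      = refl
  liftS-ren r (there v) = refl

  renF≡subF  : ∀ {Γ Δ} (r : Ren Γ Δ) (A : Form Γ) → renF r A ≡ subF (ren r) A
  renF≡subF↑ : ∀ {Γ Δ σ} (r : Ren Γ Δ) (A : Form (σ ∷ Γ)) → renF (liftR r) A ≡ subF (liftS (ren r)) A

  renF≡subF r ⊥'           = refl
  renF≡subF r (eq t u)     = cong₂ eq (renT≡subT r t) (renT≡subT r u)
  renF≡subF r (mem t u)    = cong₂ mem (renT≡subT r t) (renT≡subT r u)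
  renF≡subF r (rel R ts)   = cong (rel R) (Vec.map-cong (renT≡subT r) ts)
  renF≡subF r (or A B)     = cong₂ or (renF≡subF r A) (renF≡subF r B)
  renF≡subF r (and A B)    = cong₂ and (renF≡subF r A) (renF≡subF r B)
  renF≡subF r (imp A B)    = cong₂ imp (renF≡subF r A) (renF≡subF r B)
  renF≡subF r (all σ A)    = cong (all σ) (renF≡subF↑ r A)
  renF≡subF r (ex σ A)     = cong (ex σ) (renF≡subF↑ r A)
  renF≡subF r (ball σ t A) = cong₂ (ball σ) (renT≡subT r t) (renF≡subF↑ r A)
  renF≡subF r (bex σ t A)  = cong₂ (bex σ) (renT≡subT r t) (renF≡subF↑ r A)

  renF≡subF↑ r A = trans (renF≡subF (liftR r) A) (sym (subF-cong (liftS-ren r) A))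

  subT-subT : ∀ {Γ Δ Θ σ} (s : Subst Δ Θ) (s' : Subst Γ Δ) (t : Term Γ σ)
            → subT s (subT s' t) ≡ subT (subT s ∘ s') t
  subT-subT s s' (var v)   = refl
  subT-subT s s' (con c)   = refl
  subT-subT s s' (app t u) = cong₂ app (subT-subT s s' t) (subT-subT s s' u)

  subT-renT : ∀ {Γ Δ Θ σ} (s : Subst Δ Θ) (r : Ren Γ Δ) (t : Term Γ σ)
            → subT s (renT r t) ≡ subT (s ∘ r) t
  subT-renT s r t = trans (cong (subT s) (renT≡subT r t)) (subT-subT s _ t)

  renT-subT : ∀ {Γ Δ Θ σ} (r : Ren Δ Θ) (s : Subst Γ Δ) (t : Term Γ σ)
            → renT r (subT s t) ≡ subT (renT r ∘ s) t
  renT-subT r s t = trans (renT≡subT r (subT s t))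
                          (trans (subT-subT _ s t) (subT-cong (λ v → sym (renT≡subT r (s v))) t))

  renT-renT : ∀ {Γ Δ Θ σ} (r : Ren Δ Θ) (r' : Ren Γ Δ) (t : Term Γ σ)
            → renT r (renT r' t) ≡ renT (r ∘ r') t
  renT-renT r r' (var v)   = refl
  renT-renT r r' (con c)   = refl
  renT-renT r r' (app t u) = cong₂ app (renT-renT r r' t) (renT-renT r r' u)

  subT-var : ∀ {Γ σ} (t : Term Γ σ) → subT var t ≡ t
  subT-var (var v)   = refl
  subT-var (con c)   = refl
  subT-var (app t u) = cong₂ app (subT-var t) (subT-var u)

  liftS-subT : ∀ {Γ Δ Θ σ} (s : Subst Δ Θ) (s' : Subst Γ Δ)
             → liftS {σ = σ} (subT s ∘ s') ≗ˢ subT (liftS s) ∘ liftS s'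
  liftS-subT s s' here      = refl
  liftS-subT s s' (there v) = trans (renT-subT there s (s' v)) (sym (subT-renT (liftS s) there (s' v)))

  subF-subF  : ∀ {Γ Δ Θ} (s : Subst Δ Θ) (s' : Subst Γ Δ) (A : Form Γ)
             → subF s (subF s' A) ≡ subF (subT s ∘ s') A
  subF-subF↑ : ∀ {Γ Δ Θ σ} (s : Subst Δ Θ) (s' : Subst Γ Δ) (A : Form (σ ∷ Γ))
             → subF (liftS s) (subF (liftS s') A) ≡ subF (liftS (subT s ∘ s')) A

  subF-subF s s' ⊥'           = refl
  subF-subF s s' (eq t u)     = cong₂ eq (subT-subT s s' t) (subT-subT s s' u)
  subF-subF s s' (mem t u)    = cong₂ mem (subT-subT s s' t) (subT-subT s s' u)
  subF-subF s s' (rel R ts)   =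
    cong (rel R) (trans (sym (Vec.map-∘ (subT s) (subT s') ts)) (Vec.map-cong (subT-subT s s') ts))
  subF-subF s s' (or A B)     = cong₂ or (subF-subF s s' A) (subF-subF s s' B)
  subF-subF s s' (and A B)    = cong₂ and (subF-subF s s' A) (subF-subF s s' B)
  subF-subF s s' (imp A B)    = cong₂ imp (subF-subF s s' A) (subF-subF s s' B)
  subF-subF s s' (all σ A)    = cong (all σ) (subF-subF↑ s s' A)
  subF-subF s s' (ex σ A)     = cong (ex σ) (subF-subF↑ s s' A)
  subF-subF s s' (ball σ t A) = cong₂ (ball σ) (subT-subT s s' t) (subF-subF↑ s s' A)
  subF-subF s s' (bex σ t A)  = cong₂ (bex σ) (subT-subT s s' t) (subF-subF↑ s s' A)

  subF-subF↑ s s' A = trans (subF-subF (liftS s) (liftS s') A) (sym (subF-cong (liftS-subT s s') A))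

  liftS-var : ∀ {Γ σ} → liftS {Γ} {Γ} {σ} var ≗ˢ var
  liftS-var here      = refl
  liftS-var (there v) = refl

  subF-var  : ∀ {Γ} (A : Form Γ) → subF var A ≡ A
  subF-var↑ : ∀ {Γ σ} (A : Form (σ ∷ Γ)) → subF (liftS var) A ≡ A

  subF-var ⊥'           = refl
  subF-var (eq t u)     = cong₂ eq (subT-var t) (subT-var u)
  subF-var (mem t u)    = cong₂ mem (subT-var t) (subT-var u)
  subF-var (rel R ts)   = cong (rel R) (trans (Vec.map-cong subT-var ts) (Vec.map-id ts))
  subF-var (or A B)     = cong₂ or (subF-var A) (subF-var B)
  subF-var (and A B)    = cong₂ and (subF-var A) (subF-var B)
  subF-var (imp A B)    = cong₂ imp (subF-var A) (subF-var B)
  subF-var (all σ A)    = cong (all σ) (subF-var↑ A)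
  subF-var (ex σ A)     = cong (ex σ) (subF-var↑ A)
  subF-var (ball σ t A) = cong₂ (ball σ) (subT-var t) (subF-var↑ A)
  subF-var (bex σ t A)  = cong₂ (bex σ) (subT-var t) (subF-var↑ A)

  subF-var↑ A = trans (subF-cong liftS-var A) (subF-var A)

  subT-identity : ∀ {Γ σ} {s : Subst Γ Γ} → s ≗ˢ var → (t : Term Γ σ) → subT s t ≡ t
  subT-identity e t = trans (subT-cong e t) (subT-var t)

  subF-identity : ∀ {Γ} {s : Subst Γ Γ} → s ≗ˢ var → (A : Form Γ) → subF s A ≡ A
  subF-identity e A = trans (subF-cong e A) (subF-var A)

  renT-identity : ∀ {Γ σ} {r : Ren Γ Γ} → (∀ {τ} (v : Var Γ τ) → r v ≡ v)
                → (t : Term Γ σ) → renT r t ≡ t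
  renT-identity e t = trans (renT≡subT _ t) (subT-identity (cong var ∘ e) t)

  renF-identity : ∀ {Γ} {r : Ren Γ Γ} → (∀ {τ} (v : Var Γ τ) → r v ≡ v)
                → (A : Form Γ) → renF r A ≡ A
  renF-identity e A = trans (renF≡subF _ A) (subF-identity (cong var ∘ e) A)

  subF-renF : ∀ {Γ Δ Θ} (s : Subst Δ Θ) (r : Ren Γ Δ) (A : Form Γ) → subF s (renF r A) ≡ subF (s ∘ r) A
  subF-renF s r A = trans (cong (subF s) (renF≡subF r A)) (subF-subF s _ A)

  renF-subF : ∀ {Γ Δ Θ} (r : Ren Δ Θ) (s : Subst Γ Δ) (A : Form Γ)
            → renF r (subF s A) ≡ subF (renT r ∘ s) A
  renF-subF r s A = trans (renF≡subF r (subF s A))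
                          (trans (subF-subF _ s A) (subF-cong (λ v → sym (renT≡subT r (s v))) A))

  renF-renF : ∀ {Γ Δ Θ} (r : Ren Δ Θ) (r' : Ren Γ Δ) (A : Form Γ) → renF r (renF r' A) ≡ renF (r ∘ r') A
  renF-renF r r' A = trans (renF≡subF r _) (trans (subF-renF _ r' A) (sym (renF≡subF _ A)))

  subT-liftS-wkT : ∀ {Γ Δ σ τ} (s : Subst Γ Δ) (t : Term Γ σ)
                 → subT (liftS {σ = τ} s) (wkT t) ≡ wkT (subT s t)
  subT-liftS-wkT s t = trans (subT-renT (liftS s) there t) (sym (renT-subT there s t))

  subF-liftS-wkF : ∀ {Γ Δ τ} (s : Subst Γ Δ) (A : Form Γ)
                 → subF (liftS {σ = τ} s) (wkF A) ≡ wkF (subF s A)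
  subF-liftS-wkF s A = trans (subF-renF (liftS s) there A) (sym (renF-subF there s A))

  sub1-wkT : ∀ {Γ σ τ} (u : Term Γ τ) (t : Term Γ σ) → subT (sub1 u) (wkT t) ≡ t
  sub1-wkT u t = trans (subT-renT (sub1 u) there t) (subT-var t)

  subF-[] : ∀ {Γ Θ σ} (s : Subst Γ Θ) (t : Term Γ σ) (A : Form (σ ∷ Γ))
          → subF s (A [ t ]) ≡ subF (liftS s) A [ subT s t ]
  subF-[] s t A = trans (subF-subF s (sub1 t) A)
                        (trans (subF-cong pt A) (sym (subF-subF (sub1 (subT s t)) (liftS s) A)))
    where
    pt : subT s ∘ sub1 t ≗ˢ subT (sub1 (subT s t)) ∘ liftS s
    pt here      = refl
    pt (there v) = sym (sub1-wkT (subT s t) (s v))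

  liftR-there-[here] : ∀ {Γ σ} (A : Form (σ ∷ Γ)) → renF (liftR there) A [ var here ] ≡ A
  liftR-there-[here] A = trans (subF-renF _ _ A) (subF-identity pt A)
    where
    pt : sub1 (var here) ∘ liftR there ≗ˢ var
    pt here      = refl
    pt (there v) = refl

  split-inl : ∀ {Γ σ} (xs : List Ty) (x : Var xs σ) → split {Γ} xs (inl xs x) ≡ inj₁ x
  split-inl (_ ∷ xs) here = refl
  split-inl {Γ} (_ ∷ xs) (there x) rewrite split-inl {Γ} xs x = refl

  split-inr : ∀ {Γ σ} (xs : List Ty) (g : Var Γ σ) → split xs (inr xs g) ≡ inj₂ g
  split-inr []       g = refl
  split-inr (_ ∷ xs) g rewrite split-inr xs g = refl

  extS : ∀ {Γ Θ} (xs : List Ty) → Subst xs Θ → Subst Γ Θ → Subst (xs ++ Γ) Θ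
  extS xs ws ρ v = [ ws , ρ ] (split xs v)

  extS-inl : ∀ {Γ Θ σ} (xs : List Ty) (ws : Subst xs Θ) (ρ : Subst Γ Θ) (x : Var xs σ)
           → extS xs ws ρ (inl xs x) ≡ ws x
  extS-inl xs ws ρ x = cong [ ws , ρ ] (split-inl xs x)

  extS-inr : ∀ {Γ Θ σ} (xs : List Ty) (ws : Subst xs Θ) (ρ : Subst Γ Θ) (g : Var Γ σ)
           → extS xs ws ρ (inr xs g) ≡ ρ g
  extS-inr xs ws ρ g = cong [ ws , ρ ] (split-inr xs g)

  extS-cong : ∀ {Γ Θ} (xs : List Ty) {ws ws' : Subst xs Θ} {ρ ρ' : Subst Γ Θ}
            → ws ≗ˢ ws' → ρ ≗ˢ ρ' → extS xs ws ρ ≗ˢ extS xs ws' ρ'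
  extS-cong xs e₁ e₂ v with split xs v
  ... | inj₁ x = e₁ x
  ... | inj₂ g = e₂ g

  extS-var : ∀ {Γ} (xs : List Ty) → extS {Γ} xs (var ∘ inl xs) (var ∘ inr xs) ≗ˢ var
  extS-var []       v         = refl
  extS-var (_ ∷ xs) here      = refl
  extS-var (_ ∷ xs) (there v) with split xs v | extS-var xs v
  ... | inj₁ _ | e = cong wkT e
  ... | inj₂ _ | e = cong wkT e

  infixr 5 _∷ˢ_

  _∷ˢ_ : ∀ {xs Θ σ} → Term Θ σ → Subst xs Θ → Subst (σ ∷ xs) Θ
  (u ∷ˢ c) here      = u
  (u ∷ˢ c) (there v) = c v

  extS-there : ∀ {Θ σ} (xs : List Ty) (u : Term Θ σ) (c : Subst xs Θ)
             → extS xs c var ≗ˢ extS (σ ∷ xs) (u ∷ˢ c) var ∘ there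
  extS-there xs u c v with split xs v
  ... | inj₁ _ = refl
  ... | inj₂ _ = refl

  sub1-liftS-extS : ∀ {Θ σ} (xs : List Ty) (u : Term Θ σ) (c : Subst xs Θ)
                  → subT (sub1 u) ∘ liftS (extS xs c var) ≗ˢ extS (σ ∷ xs) (u ∷ˢ c) var
  sub1-liftS-extS xs u c here      = refl
  sub1-liftS-extS xs u c (there v) = trans (sub1-wkT u _) (extS-there xs u c v)

  extS-plug : ∀ {Θ σ} (xs : List Ty) (u : Term Θ σ) (c : Subst xs Θ)
            → subT (extS xs c var) ∘ (renT (inr xs) u ∷ˢ var) ≗ˢ extS (σ ∷ xs) (u ∷ˢ c) var
  extS-plug xs u c here      = trans (subT-renT _ _ u) (subT-identity (extS-inr xs c var) u)
  extS-plug xs u c (there v) = extS-there xs u c v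

  wkS : ∀ {Γ Θ} (xs : List Ty) → Subst Γ Θ → Subst Γ (xs ++ Θ)
  wkS xs ρ = renT (inr xs) ∘ ρ

  fresh : ∀ {Θ} (xs : List Ty) → Subst xs (xs ++ Θ)
  fresh xs = var ∘ inl xs

  liftSs : ∀ {Γ Θ} (xs : List Ty) → Subst Γ Θ → Subst (xs ++ Γ) (xs ++ Θ)
  liftSs xs s = extS xs (fresh xs) (wkS xs s)

  -- Herbrand forms

  HForm : List Ty → Set
  HForm Γ = Σ (List Ty) λ xs → Form (xs ++ Γ)

  hr : ∀ {Γ} → Form Γ → HForm Γ
  hr A = W A , HR A

  inst : ∀ {Γ Θ} (X : HForm Γ) → Subst Γ Θ → Subst (proj₁ X) Θ → Form Θ
  inst X ρ ws = subF (extS (proj₁ X) ws ρ) (proj₂ X)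

  inst-cong : ∀ {Γ Θ} (X : HForm Γ) {ρ ρ' : Subst Γ Θ} {ws ws' : Subst (proj₁ X) Θ}
            → ρ ≗ˢ ρ' → ws ≗ˢ ws' → inst X ρ ws ≡ inst X ρ' ws'
  inst-cong (xs , F) e₁ e₂ = subF-cong (extS-cong xs e₂ e₁) F

  -- These mirror the clauses of W and HR, so that hr (or A B) is orH (hr A) (hr B) by definition, etc.
  orH andH impH : ∀ {Γ} → HForm Γ → HForm Γ → HForm Γ
  orH  (xs , F) (ys , F') = xs ++ ys , or  (renF (rLeft xs ys) F) (renF (rRight xs ys) F')
  andH (xs , F) (ys , F') = xs ++ ys , and (renF (rLeft xs ys) F) (renF (rRight xs ys) F')
  impH (xs , F) (ys , F') = map (arrows xs) ys ,
    allN xs (imp (renF (rImpA xs (map (arrows xs) ys)) F) (subF (sImpB xs ys) F'))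

  allH exH : ∀ {Γ} σ → HForm (σ ∷ Γ) → HForm Γ
  allH σ (xs , F) = map (σ ⇒_) xs , all σ (subF (sAll xs) F)
  exH  σ (xs , F) = σ * ∷ xs , bex σ (var here) (renF (rEx xs) F)

  ballH bexH : ∀ {Γ} σ → Term Γ (σ *) → HForm (σ ∷ Γ) → HForm Γ
  ballH σ t (xs , F) = xs , ball σ (renT (inr xs) t) (renF (rBd xs) F)
  bexH  σ t (xs , F) = xs , bex  σ (renT (inr xs) t) (renF (rBd xs) F)

  subH : ∀ {Γ Δ} → Subst Γ Δ → HForm Γ → HForm Δ
  subH s (xs , F) = xs , subF (liftSs xs s) F

  inst-atomic : ∀ {Γ Θ} (F : Form Γ) (ρ : Subst Γ Θ) (ws : Subst [] Θ) → inst ([] , F) ρ ws ≡ subF ρ F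
  inst-atomic F ρ ws = subF-cong (λ _ → refl) F

  extS-rLeft : ∀ {Γ Θ} (xs ys : List Ty) (ws : Subst (xs ++ ys) Θ) (ρ : Subst Γ Θ)
             → extS (xs ++ ys) ws ρ ∘ rLeft xs ys ≗ˢ extS xs (ws ∘ inl xs) ρ
  extS-rLeft xs ys ws ρ v with split xs v
  ... | inj₁ x = extS-inl (xs ++ ys) ws ρ (inl xs x)
  ... | inj₂ g = extS-inr (xs ++ ys) ws ρ g

  extS-rRight : ∀ {Γ Θ} (xs ys : List Ty) (ws : Subst (xs ++ ys) Θ) (ρ : Subst Γ Θ)
              → extS (xs ++ ys) ws ρ ∘ rRight xs ys ≗ˢ extS ys (ws ∘ inr xs) ρ
  extS-rRight xs ys ws ρ v with split ys v
  ... | inj₁ y = extS-inl (xs ++ ys) ws ρ (inr xs y)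
  ... | inj₂ g = extS-inr (xs ++ ys) ws ρ g

  inst-or : ∀ {Γ Θ} (X Y : HForm Γ) (ρ : Subst Γ Θ) (ws : Subst (proj₁ X ++ proj₁ Y) Θ)
          → inst (orH X Y) ρ ws ≡ or (inst X ρ (ws ∘ inl (proj₁ X))) (inst Y ρ (ws ∘ inr (proj₁ X)))
  inst-or (xs , F) (ys , F') ρ ws =
    cong₂ or (trans (subF-renF _ _ F) (subF-cong (extS-rLeft xs ys ws ρ) F))
             (trans (subF-renF _ _ F') (subF-cong (extS-rRight xs ys ws ρ) F'))

  inst-and : ∀ {Γ Θ} (X Y : HForm Γ) (ρ : Subst Γ Θ) (ws : Subst (proj₁ X ++ proj₁ Y) Θ)
           → inst (andH X Y) ρ ws ≡ and (inst X ρ (ws ∘ inl (proj₁ X))) (inst Y ρ (ws ∘ inr (proj₁ X)))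
  inst-and (xs , F) (ys , F') ρ ws =
    cong₂ and (trans (subF-renF _ _ F) (subF-cong (extS-rLeft xs ys ws ρ) F))
              (trans (subF-renF _ _ F') (subF-cong (extS-rRight xs ys ws ρ) F'))

  subF-allN : ∀ {Γ Θ} (xs : List Ty) (s : Subst Γ Θ) (A : Form (xs ++ Γ))
            → subF s (allN xs A) ≡ allN xs (subF (liftSs xs s) A)
  subF-allN []       s A = subF-cong (λ v → sym (renT-identity (λ _ → refl) (s v))) A
  subF-allN (σ ∷ xs) s A = trans (subF-allN xs s (all σ A)) (cong (allN xs ∘ all σ) (subF-cong pt A))
    where
    pt : liftS (liftSs xs s) ≗ˢ liftSs (σ ∷ xs) s
    pt here = refl
    pt (there v) with split xs v
    ... | inj₁ _ = refl
    ... | inj₂ g = renT-renT there (inr xs) (s g)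

  subT-applyAll : ∀ {Δ Θ τ} (xs : List Ty) (s : Subst Δ Θ) (t : Term Δ (arrows xs τ)) (args : Subst xs Δ)
                → subT s (applyAll xs t args) ≡ applyAll xs (subT s t) (subT s ∘ args)
  subT-applyAll []       s t args = refl
  subT-applyAll (σ ∷ xs) s t args = subT-applyAll xs s (app t (args here)) (args ∘ there)

  applyAll-cong : ∀ {Δ τ} (xs : List Ty) {t t' : Term Δ (arrows xs τ)} {args args' : Subst xs Δ}
                → t ≡ t' → args ≗ˢ args' → applyAll xs t args ≡ applyAll xs t' args'
  applyAll-cong []       e₁ e₂ = e₁
  applyAll-cong (σ ∷ xs) e₁ e₂ = applyAll-cong xs (cong₂ app e₁ (e₂ here)) (e₂ ∘ there)

  applyFresh : ∀ {Θ τ} (xs : List Ty) → Term Θ (arrows xs τ) → Term (xs ++ Θ) τ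
  applyFresh xs t = applyAll xs (renT (inr xs) t) (fresh xs)

  inst-imp : ∀ {Γ Θ} (X Y : HForm Γ) (ρ : Subst Γ Θ) (U : Subst (proj₁ (impH X Y)) Θ)
           → let xs = proj₁ X in
             inst (impH X Y) ρ U ≡
             allN xs (imp (inst X (wkS xs ρ) (fresh xs))
                          (inst Y (wkS xs ρ) (applyFresh xs ∘ U ∘ mapVar (arrows xs))))
  inst-imp {Γ} {Θ} (xs , F) (ys , F') ρ U =
    trans (subF-allN xs s _)
          (cong (allN xs) (cong₂ imp (trans (subF-renF _ _ F) (subF-cong ptA F))
                                     (trans (subF-subF _ _ F') (subF-cong ptB F'))))
    where
    us = map (arrows xs) ys
    s : Subst (us ++ Γ) Θ
    s = extS us U ρ
    ptA : liftSs xs s ∘ rImpA xs us ≗ˢ extS xs (fresh xs) (wkS xs ρ)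
    ptA v with split xs v
    ... | inj₁ x = extS-inl xs (fresh xs) (wkS xs s) x
    ... | inj₂ g = trans (extS-inr xs (fresh xs) (wkS xs s) (inr us g)) (cong (renT (inr xs)) (extS-inr us U ρ g))
    ptB : subT (liftSs xs s) ∘ sImpB xs ys ≗ˢ extS ys (applyFresh xs ∘ U ∘ mapVar (arrows xs)) (wkS xs ρ)
    ptB v with split ys v
    ... | inj₁ y = trans (subT-applyAll xs (liftSs xs s) _ _)
                         (applyAll-cong xs (trans (extS-inr xs (fresh xs) (wkS xs s) (inl us (mapVar (arrows xs) y)))
                                                  (cong (renT (inr xs)) (extS-inl us U ρ _)))
                                           (extS-inl xs (fresh xs) (wkS xs s)))
    ... | inj₂ g = trans (extS-inr xs (fresh xs) (wkS xs s) (inr us g)) (cong (renT (inr xs)) (extS-inr us U ρ g))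

  inst-all : ∀ {Γ Θ} σ (X : HForm (σ ∷ Γ)) (ρ : Subst Γ Θ) (ws : Subst (proj₁ (allH σ X)) Θ)
           → inst (allH σ X) ρ ws
             ≡ all σ (inst X (liftS ρ) (λ x → app (wkT (ws (mapVar (σ ⇒_) x))) (var here)))
  inst-all σ (xs , F) ρ ws = cong (all σ) (trans (subF-subF _ _ F) (subF-cong pt F))
    where
    us = map (σ ⇒_) xs
    pt : subT (liftS (extS us ws ρ)) ∘ sAll xs
         ≗ˢ extS xs (λ x → app (wkT (ws (mapVar (σ ⇒_) x))) (var here)) (liftS ρ)
    pt v with split xs v
    ... | inj₁ x         = cong (λ z → app (wkT z) (var here)) (extS-inl us ws ρ (mapVar (σ ⇒_) x))
    ... | inj₂ here      = refl
    ... | inj₂ (there g) = cong wkT (extS-inr us ws ρ g)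

  inst-ex : ∀ {Γ Θ} σ (X : HForm (σ ∷ Γ)) (ρ : Subst Γ Θ) (ws : Subst (proj₁ (exH σ X)) Θ)
          → inst (exH σ X) ρ ws ≡ bex σ (ws here) (inst X (liftS ρ) (wkT ∘ ws ∘ there))
  inst-ex σ (xs , F) ρ ws = cong (bex σ (ws here)) (trans (subF-renF _ _ F) (subF-cong pt F))
    where
    pt : liftS (extS (σ * ∷ xs) ws ρ) ∘ rEx xs ≗ˢ extS xs (wkT ∘ ws ∘ there) (liftS ρ)
    pt v with split xs v
    ... | inj₁ x         = cong wkT (extS-inl (σ * ∷ xs) ws ρ (there x))
    ... | inj₂ here      = refl
    ... | inj₂ (there g) = cong wkT (extS-inr (σ * ∷ xs) ws ρ g)

  extS-rBd : ∀ {Γ Θ σ} (xs : List Ty) (ρ : Subst Γ Θ) (ws : Subst xs Θ)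
           → liftS {σ = σ} (extS xs ws ρ) ∘ rBd xs ≗ˢ extS xs (wkT ∘ ws) (liftS ρ)
  extS-rBd xs ρ ws v with split xs v
  ... | inj₁ x         = cong wkT (extS-inl xs ws ρ x)
  ... | inj₂ here      = refl
  ... | inj₂ (there g) = cong wkT (extS-inr xs ws ρ g)

  inst-ball : ∀ {Γ Θ} σ t (X : HForm (σ ∷ Γ)) (ρ : Subst Γ Θ) (ws : Subst (proj₁ X) Θ)
            → inst (ballH σ t X) ρ ws ≡ ball σ (subT ρ t) (inst X (liftS ρ) (wkT ∘ ws))
  inst-ball σ t (xs , F) ρ ws = cong₂ (ball σ) (trans (subT-renT _ _ t) (subT-cong (extS-inr xs ws ρ) t))
                                               (trans (subF-renF _ _ F) (subF-cong (extS-rBd xs ρ ws) F))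

  inst-bex : ∀ {Γ Θ} σ t (X : HForm (σ ∷ Γ)) (ρ : Subst Γ Θ) (ws : Subst (proj₁ X) Θ)
           → inst (bexH σ t X) ρ ws ≡ bex σ (subT ρ t) (inst X (liftS ρ) (wkT ∘ ws))
  inst-bex σ t (xs , F) ρ ws = cong₂ (bex σ) (trans (subT-renT _ _ t) (subT-cong (extS-inr xs ws ρ) t))
                                             (trans (subF-renF _ _ F) (subF-cong (extS-rBd xs ρ ws) F))

  subF-inst : ∀ {Γ Θ Θ'} (X : HForm Γ) (s : Subst Θ Θ') (ρ : Subst Γ Θ) (ws : Subst (proj₁ X) Θ)
            → subF s (inst X ρ ws) ≡ inst X (subT s ∘ ρ) (subT s ∘ ws)
  subF-inst (xs , F) s ρ ws = trans (subF-subF _ _ F) (subF-cong pt F)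
    where
    pt : subT s ∘ extS xs ws ρ ≗ˢ extS xs (subT s ∘ ws) (subT s ∘ ρ)
    pt v with split xs v
    ... | inj₁ _ = refl
    ... | inj₂ _ = refl

  renF-inst : ∀ {Γ Θ Θ'} (X : HForm Γ) (r : Ren Θ Θ') (ρ : Subst Γ Θ) (ws : Subst (proj₁ X) Θ)
            → renF r (inst X ρ ws) ≡ inst X (renT r ∘ ρ) (renT r ∘ ws)
  renF-inst X r ρ ws =
    trans (renF≡subF r _) (trans (subF-inst X _ ρ ws) (inst-cong X (sym ∘ renT≡subT r ∘ ρ) (sym ∘ renT≡subT r ∘ ws)))

  inst-subH : ∀ {Γ Δ Θ} (X : HForm Γ) (s : Subst Γ Δ) (ρ : Subst Δ Θ) (ws : Subst (proj₁ X) Θ)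
            → inst (subH s X) ρ ws ≡ inst X (subT ρ ∘ s) ws
  inst-subH (xs , F) s ρ ws = trans (subF-subF _ _ F) (subF-cong pt F)
    where
    pt : subT (extS xs ws ρ) ∘ liftSs xs s ≗ˢ extS xs ws (subT ρ ∘ s)
    pt v with split xs v
    ... | inj₁ x = extS-inl xs ws ρ x
    ... | inj₂ g = trans (subT-renT _ _ (s g)) (subT-cong (extS-inr xs ws ρ) (s g))

  inst-subH-liftS : ∀ {Γ Δ Θ σ} (X : HForm (σ ∷ Γ)) (s : Subst Γ Δ) (ρ : Subst Δ Θ)
                    (ws : Subst (proj₁ X) (σ ∷ Θ))
                  → inst (subH (liftS s) X) (liftS ρ) ws ≡ inst X (liftS (subT ρ ∘ s)) ws
  inst-subH-liftS X s ρ ws =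
    trans (inst-subH X (liftS s) (liftS ρ) ws) (inst-cong X (sym ∘ liftS-subT ρ s) λ _ → refl)

  matrix-ext : ∀ {Γ} (xs : List Ty) {F F' : Form (xs ++ Γ)}
             → (∀ {Θ} (ρ : Subst Γ Θ) (ws : Subst xs Θ) → inst (xs , F) ρ ws ≡ inst (xs , F') ρ ws)
             → F ≡ F'
  matrix-ext xs {F} {F'} h =
    trans (sym (subF-identity (extS-var xs) F)) (trans (h _ _) (subF-identity (extS-var xs) F'))

  subH-atomic : ∀ {Γ Δ} (s : Subst Γ Δ) (F : Form Γ) → ([] , subF s F) ≡ subH s ([] , F)
  subH-atomic s F = cong ([] ,_) (subF-cong (λ v → sym (renT-identity (λ _ → refl) (s v))) F)

  subH-or : ∀ {Γ Δ} (s : Subst Γ Δ) (X Y : HForm Γ) → orH (subH s X) (subH s Y) ≡ subH s (orH X Y)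
  subH-or s X@(xs , _) Y@(ys , _) = cong (xs ++ ys ,_) (matrix-ext (xs ++ ys) λ ρ ws →
    trans (inst-or (subH s X) (subH s Y) ρ ws)
    (trans (cong₂ or (inst-subH X s ρ _) (inst-subH Y s ρ _))
    (sym (trans (inst-subH (orH X Y) s ρ ws) (inst-or X Y _ ws)))))

  subH-and : ∀ {Γ Δ} (s : Subst Γ Δ) (X Y : HForm Γ) → andH (subH s X) (subH s Y) ≡ subH s (andH X Y)
  subH-and s X@(xs , _) Y@(ys , _) = cong (xs ++ ys ,_) (matrix-ext (xs ++ ys) λ ρ ws →
    trans (inst-and (subH s X) (subH s Y) ρ ws)
    (trans (cong₂ and (inst-subH X s ρ _) (inst-subH Y s ρ _))
    (sym (trans (inst-subH (andH X Y) s ρ ws) (inst-and X Y _ ws)))))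

  subH-imp : ∀ {Γ Δ} (s : Subst Γ Δ) (X Y : HForm Γ) → impH (subH s X) (subH s Y) ≡ subH s (impH X Y)
  subH-imp s X@(xs , _) Y@(ys , _) = cong (map (arrows xs) ys ,_) (matrix-ext (map (arrows xs) ys) λ ρ ws →
    trans (inst-imp (subH s X) (subH s Y) ρ ws)
    (trans (cong (allN xs) (cong₂ imp (trans (inst-subH X s _ _) (inst-cong X (wkS-subT ρ) λ _ → refl))
                                      (trans (inst-subH Y s _ _) (inst-cong Y (wkS-subT ρ) λ _ → refl))))
    (sym (trans (inst-subH (impH X Y) s ρ ws) (inst-imp X Y _ ws)))))
    where
    wkS-subT : ∀ {Θ} (ρ : Subst _ Θ) → subT (wkS xs ρ) ∘ s ≗ˢ wkS xs (subT ρ ∘ s)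
    wkS-subT ρ g = sym (renT-subT (inr xs) ρ (s g))

  subH-all : ∀ {Γ Δ} σ (s : Subst Γ Δ) (X : HForm (σ ∷ Γ)) → allH σ (subH (liftS s) X) ≡ subH s (allH σ X)
  subH-all σ s X@(xs , _) = cong (map (σ ⇒_) xs ,_) (matrix-ext (map (σ ⇒_) xs) λ ρ ws →
    trans (inst-all σ (subH (liftS s) X) ρ ws)
    (trans (cong (all σ) (inst-subH-liftS X s ρ _))
    (sym (trans (inst-subH (allH σ X) s ρ ws) (inst-all σ X _ ws)))))

  subH-ex : ∀ {Γ Δ} σ (s : Subst Γ Δ) (X : HForm (σ ∷ Γ)) → exH σ (subH (liftS s) X) ≡ subH s (exH σ X)
  subH-ex σ s X@(xs , _) = cong (σ * ∷ xs ,_) (matrix-ext (σ * ∷ xs) λ ρ ws →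
    trans (inst-ex σ (subH (liftS s) X) ρ ws)
    (trans (cong (bex σ (ws here)) (inst-subH-liftS X s ρ _))
    (sym (trans (inst-subH (exH σ X) s ρ ws) (inst-ex σ X _ ws)))))

  subH-ball : ∀ {Γ Δ} σ (s : Subst Γ Δ) t (X : HForm (σ ∷ Γ))
            → ballH σ (subT s t) (subH (liftS s) X) ≡ subH s (ballH σ t X)
  subH-ball σ s t X@(xs , _) = cong (xs ,_) (matrix-ext xs λ ρ ws →
    trans (inst-ball σ (subT s t) (subH (liftS s) X) ρ ws)
    (trans (cong₂ (ball σ) (subT-subT ρ s t) (inst-subH-liftS X s ρ _))
    (sym (trans (inst-subH (ballH σ t X) s ρ ws) (inst-ball σ t X _ ws)))))

  subH-bex : ∀ {Γ Δ} σ (s : Subst Γ Δ) t (X : HForm (σ ∷ Γ))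
           → bexH σ (subT s t) (subH (liftS s) X) ≡ subH s (bexH σ t X)
  subH-bex σ s t X@(xs , _) = cong (xs ,_) (matrix-ext xs λ ρ ws →
    trans (inst-bex σ (subT s t) (subH (liftS s) X) ρ ws)
    (trans (cong₂ (bex σ) (subT-subT ρ s t) (inst-subH-liftS X s ρ _))
    (sym (trans (inst-subH (bexH σ t X) s ρ ws) (inst-bex σ t X _ ws)))))

  hr-subF : ∀ {Γ Δ} (s : Subst Γ Δ) (A : Form Γ) → hr (subF s A) ≡ subH s (hr A)
  hr-subF s ⊥'           = subH-atomic s ⊥'
  hr-subF s (eq t u)     = subH-atomic s (eq t u)
  hr-subF s (mem t u)    = subH-atomic s (mem t u)
  hr-subF s (rel R ts)   = subH-atomic s (rel R ts)
  hr-subF s (or A B)     = trans (cong₂ orH (hr-subF s A) (hr-subF s B)) (subH-or s (hr A) (hr B))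
  hr-subF s (and A B)    = trans (cong₂ andH (hr-subF s A) (hr-subF s B)) (subH-and s (hr A) (hr B))
  hr-subF s (imp A B)    = trans (cong₂ impH (hr-subF s A) (hr-subF s B)) (subH-imp s (hr A) (hr B))
  hr-subF s (all σ A)    = trans (cong (allH σ) (hr-subF (liftS s) A)) (subH-all σ s (hr A))
  hr-subF s (ex σ A)     = trans (cong (exH σ) (hr-subF (liftS s) A)) (subH-ex σ s (hr A))
  hr-subF s (ball σ t A) = trans (cong (ballH σ (subT s t)) (hr-subF (liftS s) A)) (subH-ball σ s t (hr A))
  hr-subF s (bex σ t A)  = trans (cong (bexH σ (subT s t)) (hr-subF (liftS s) A)) (subH-bex σ s t (hr A))

  Atomic-subF : ∀ {Γ Δ} {A : Form Γ} (s : Subst Γ Δ) → Atomic A → Atomic (subF s A)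
  Atomic-subF s at-⊥          = at-⊥
  Atomic-subF s (at-eq t u)   = at-eq _ _
  Atomic-subF s (at-mem t u)  = at-mem _ _
  Atomic-subF s (at-rel R ts) = at-rel R _

  ExFree-subF : ∀ {Γ Δ} {A : Form Γ} (s : Subst Γ Δ) → ExFree A → ExFree (subF s A)
  ExFree-subF s (ef-at a)    = ef-at (Atomic-subF s a)
  ExFree-subF s (ef-or a b)  = ef-or (ExFree-subF s a) (ExFree-subF s b)
  ExFree-subF s (ef-and a b) = ef-and (ExFree-subF s a) (ExFree-subF s b)
  ExFree-subF s (ef-imp a b) = ef-imp (ExFree-subF s a) (ExFree-subF s b)
  ExFree-subF s (ef-all a)   = ef-all (ExFree-subF (liftS s) a)
  ExFree-subF s (ef-ball a)  = ef-ball (ExFree-subF (liftS s) a)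
  ExFree-subF s (ef-bex a)   = ef-bex (ExFree-subF (liftS s) a)

  hr-atomic : ∀ {Γ} {A : Form Γ} → Atomic A → hr A ≡ ([] , A)
  hr-atomic at-⊥          = refl
  hr-atomic (at-eq t u)   = refl
  hr-atomic (at-mem t u)  = refl
  hr-atomic (at-rel R ts) = refl

  sAll-[] : ∀ {Γ σ} → sAll {Γ} {σ} [] ≗ˢ var
  sAll-[] here      = refl
  sAll-[] (there v) = refl

  rBd-[] : ∀ {Γ σ τ} (v : Var (σ ∷ Γ) τ) → rBd [] v ≡ v
  rBd-[] here      = refl
  rBd-[] (there v) = refl

  hr-∃free : ∀ {Γ} {A : Form Γ} → ExFree A → hr A ≡ ([] , A)
  hr-∃free (ef-at a) = hr-atomic a
  hr-∃free {A = or A B} (ef-or a b) = trans (cong₂ orH (hr-∃free a) (hr-∃free b))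
    (cong ([] ,_) (cong₂ or (renF-identity (λ _ → refl) A) (renF-identity (λ _ → refl) B)))
  hr-∃free {A = and A B} (ef-and a b) = trans (cong₂ andH (hr-∃free a) (hr-∃free b))
    (cong ([] ,_) (cong₂ and (renF-identity (λ _ → refl) A) (renF-identity (λ _ → refl) B)))
  hr-∃free {A = imp A B} (ef-imp a b) = trans (cong₂ impH (hr-∃free a) (hr-∃free b))
    (cong ([] ,_) (cong₂ imp (renF-identity (λ _ → refl) A) (subF-identity (λ _ → refl) B)))
  hr-∃free {A = all σ A} (ef-all a) = trans (cong (allH σ) (hr-∃free a))
    (cong ([] ,_) (cong (all σ) (subF-identity sAll-[] A)))
  hr-∃free {A = ball σ t A} (ef-ball a) = trans (cong (ballH σ t) (hr-∃free a))
    (cong ([] ,_) (cong₂ (ball σ) (renT-identity (λ _ → refl) t) (renF-identity rBd-[] A)))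
  hr-∃free {A = bex σ t A} (ef-bex a) = trans (cong (bexH σ t) (hr-∃free a))
    (cong ([] ,_) (cong₂ (bex σ) (renT-identity (λ _ → refl) t) (renF-identity rBd-[] A)))

  -- Combinators, unions and Herbrand inclusion

  K : ∀ {Γ σ τ} → Term Γ σ → Term Γ (τ ⇒ σ)
  K {σ = σ} {τ} x = app (con (Πc σ τ)) x

  S : ∀ {Γ ρ σ τ} → Term Γ (ρ ⇒ σ ⇒ τ) → Term Γ (ρ ⇒ σ) → Term Γ (ρ ⇒ τ)
  S {ρ = ρ} {σ} {τ} f g = app (app (con (Σc ρ σ τ)) f) g

  I : ∀ {Γ σ} → Term Γ (σ ⇒ σ)
  I {σ = σ} = S {σ = σ ⇒ σ} (con (Πc σ (σ ⇒ σ))) (con (Πc σ σ))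

  lam : ∀ {Γ σ τ} → Term (σ ∷ Γ) τ → Term Γ (σ ⇒ τ)
  lam (var here)      = I
  lam (var (there v)) = K (var v)
  lam (con c)         = K (con c)
  lam (app t u)       = S (lam t) (lam u)

  swapR : ∀ {Δ σ} (xs : List Ty) → Ren (σ ∷ xs ++ Δ) (xs ++ σ ∷ Δ)
  swapR xs here = inr xs here
  swapR xs (there v) = [ inl xs , inr xs ∘ there ] (split xs v)

  lams : ∀ {Δ τ} (xs : List Ty) → Term (xs ++ Δ) τ → Term Δ (arrows xs τ)
  lams []       t = t
  lams (σ ∷ xs) t = lam (lams xs (renT (swapR xs) t))

  -- Default witnesses (for ⊥E and ∨I) exist because L has a constant symbol.
  inhabitant : ∀ {Θ} (τ : Ty) → Term Θ τ
  inhabitant {Θ} G = subst (λ n → Term Θ (arrows (replicate n G) G)) c₀-const (con (fun c₀))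
  inhabitant (σ ⇒ τ) = K (inhabitant τ)
  inhabitant (σ *)   = app (con (sng σ)) (inhabitant σ)

  renT-lam : ∀ {Γ Δ σ τ} (r : Ren Γ Δ) (t : Term (σ ∷ Γ) τ) → renT r (lam t) ≡ lam (renT (liftR r) t)
  renT-lam r (var here)      = refl
  renT-lam r (var (there v)) = refl
  renT-lam r (con c)         = refl
  renT-lam r (app t u)       = cong₂ S (renT-lam r t) (renT-lam r u)

  close : ∀ {τ} (Γ : List Ty) → Term Γ τ → Term [] (arrows Γ τ)
  close Γ t = lams Γ (renT (inl Γ) t)

  EndsInStar : Ty → Set
  EndsInStar G       = ⊥
  EndsInStar (σ ⇒ τ) = EndsInStar τ
  EndsInStar (σ *)   = ⊤

  AllEndInStar : List Ty → Set
  AllEndInStar xs = ∀ {τ} → Var xs τ → EndsInStar τ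

  ++-endsInStar : ∀ (xs ys : List Ty) → AllEndInStar xs → AllEndInStar ys → AllEndInStar (xs ++ ys)
  ++-endsInStar []       ys p q v         = q v
  ++-endsInStar (x ∷ xs) ys p q here      = p here
  ++-endsInStar (x ∷ xs) ys p q (there v) = ++-endsInStar xs ys (p ∘ there) q v

  map-endsInStar : ∀ (f : Ty → Ty) → (∀ τ → EndsInStar τ → EndsInStar (f τ))
                 → (xs : List Ty) → AllEndInStar xs → AllEndInStar (map f xs)
  map-endsInStar f pf (x ∷ xs) p here      = pf x (p here)
  map-endsInStar f pf (x ∷ xs) p (there v) = map-endsInStar f pf xs (p ∘ there) v

  arrows-endsInStar : ∀ (xs : List Ty) τ → EndsInStar τ → EndsInStar (arrows xs τ)
  arrows-endsInStar []       τ p = p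
  arrows-endsInStar (x ∷ xs) τ p = arrows-endsInStar xs τ p

  W-endsInStar : ∀ {Γ} (A : Form Γ) → AllEndInStar (W A)
  W-endsInStar ⊥'           ()
  W-endsInStar (eq t u)     ()
  W-endsInStar (mem t u)    ()
  W-endsInStar (rel R ts)   ()
  W-endsInStar (or A B)     = ++-endsInStar (W A) (W B) (W-endsInStar A) (W-endsInStar B)
  W-endsInStar (and A B)    = ++-endsInStar (W A) (W B) (W-endsInStar A) (W-endsInStar B)
  W-endsInStar (imp A B)    = map-endsInStar (arrows (W A)) (arrows-endsInStar (W A)) (W B) (W-endsInStar B)
  W-endsInStar (all σ A)    = map-endsInStar (σ ⇒_) (λ _ p → p) (W A) (W-endsInStar A)
  W-endsInStar (ex σ A)     here      = tt
  W-endsInStar (ex σ A)     (there v) = W-endsInStar A v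
  W-endsInStar (ball σ t A) = W-endsInStar A
  W-endsInStar (bex σ t A)  = W-endsInStar A

  -- At G this is mere equality; it is only used at witness types, which end in a star (W-endsInStar).
  Incl : ∀ {Γ} (τ : Ty) → Term Γ τ → Term Γ τ → Form Γ
  Incl G       a b = eq a b
  Incl (σ ⇒ τ) f g = all σ (Incl τ (app (wkT f) (var here)) (app (wkT g) (var here)))
  Incl (σ *)   a b = all σ (imp (mem (var here) (wkT a)) (mem (var here) (wkT b)))

  subF-Incl : ∀ {Γ Θ} (s : Subst Γ Θ) (τ : Ty) (a b : Term Γ τ)
            → subF s (Incl τ a b) ≡ Incl τ (subT s a) (subT s b)
  subF-Incl s G       a b = refl
  subF-Incl s (σ ⇒ τ) a b = cong (all σ) (trans (subF-Incl (liftS s) τ _ _)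
    (cong₂ (λ x y → Incl τ (app x (var here)) (app y (var here))) (subT-liftS-wkT s a) (subT-liftS-wkT s b)))
  subF-Incl s (σ *)   a b =
    cong (all σ) (cong₂ (λ x y → imp (mem (var here) x) (mem (var here) y)) (subT-liftS-wkT s a) (subT-liftS-wkT s b))

  renF-Incl : ∀ {Γ Θ} (r : Ren Γ Θ) (τ : Ty) (a b : Term Γ τ)
            → renF r (Incl τ a b) ≡ Incl τ (renT r a) (renT r b)
  renF-Incl r τ a b =
    trans (renF≡subF r _) (trans (subF-Incl _ τ a b) (sym (cong₂ (Incl τ) (renT≡subT r a) (renT≡subT r b))))

  union : ∀ {Θ} (τ : Ty) → EndsInStar τ → Term Θ τ → Term Θ τ → Term Θ τ
  union G       () a b
  union (σ ⇒ τ) p  f g = lam (union τ p (app (wkT f) (var here)) (app (wkT g) (var here)))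
  union (σ *)   p  a b = app (app (con (cup σ)) a) b

  bigUnion : ∀ {Θ σ} (τ : Ty) → EndsInStar τ → Term Θ (σ *) → Term Θ (σ ⇒ τ) → Term Θ τ
  bigUnion G       () Z f
  bigUnion {σ = σ} (ρ *)   p Z f = app (app (con (bigcup σ ρ)) Z) f
  bigUnion {σ = σ} (ρ ⇒ τ) p Z f =
    lam (bigUnion τ p (wkT Z) (lam (app (app (wkT (wkT f)) (var here)) (var (there here)))))

  renT-bigUnion : ∀ {Γ Δ σ} (τ : Ty) (p : EndsInStar τ) (r : Ren Γ Δ) (Z : Term Γ (σ *))
                  (f : Term Γ (σ ⇒ τ)) → renT r (bigUnion τ p Z f) ≡ bigUnion τ p (renT r Z) (renT r f)
  renT-bigUnion G () r Z f
  renT-bigUnion (ρ *) p r Z f = refl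
  renT-bigUnion {σ = σ} (ρ ⇒ τ) p r Z f =
    trans (renT-lam r (bigUnion τ p (wkT Z) (lam inner)))
          (cong lam (trans (renT-bigUnion τ p (liftR r) (wkT Z) (lam inner))
                           (cong₂ (bigUnion τ p) (trans (renT-renT (liftR r) there Z) (sym (renT-renT there r Z)))
                                                 (trans (renT-lam (liftR r) inner)
                                                        (cong (λ z → lam (app (app z (var here)) (var (there here))))
                                                              wk²)))))
    where
    inner = app (app (wkT {τ = σ} (wkT {τ = ρ} f)) (var here)) (var (there here))
    wk² : renT (liftR (liftR r)) (wkT (wkT f)) ≡ wkT {τ = σ} (wkT {τ = ρ} (renT r f))
    wk² = trans (renT-renT (liftR (liftR r)) there (wkT f))
                (trans (renT-renT (there ∘ liftR r) there f)
                       (sym (trans (renT-renT there there (renT r f)) (renT-renT (there ∘ there) r f))))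

  -- Derivations

  weaken : ∀ {Ax : Axioms} {Γ} {Δ Δ' : List (Form Γ)} {A} → Δ ⊆ Δ' → Der Ax Δ A → Der Ax Δ' A
  weaken p (hyp m)      = hyp (p m)
  weaken p (ax a)       = ax a
  weaken p (⊥E d)       = ⊥E (weaken p d)
  weaken p (∧I d e)     = ∧I (weaken p d) (weaken p e)
  weaken p (∧E₁ d)      = ∧E₁ (weaken p d)
  weaken p (∧E₂ d)      = ∧E₂ (weaken p d)
  weaken p (∨I₁ d)      = ∨I₁ (weaken p d)
  weaken p (∨I₂ d)      = ∨I₂ (weaken p d)
  weaken p (∨E d e f)   = ∨E (weaken p d) (weaken (∷⁺ʳ _ p) e) (weaken (∷⁺ʳ _ p) f)
  weaken p (→I d)       = →I (weaken (∷⁺ʳ _ p) d)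
  weaken p (→E d e)     = →E (weaken p d) (weaken p e)
  weaken p (∀I d)       = ∀I (weaken (map⁺ wkF p) d)
  weaken p (∀E d t)     = ∀E (weaken p d) t
  weaken p (∃I t d)     = ∃I t (weaken p d)
  weaken p (∃E d e)     = ∃E (weaken p d) (weaken (∷⁺ʳ _ (map⁺ wkF p)) e)

  wkHyp : ∀ {Ax : Axioms} {Γ} {Δ : List (Form Γ)} {A B} → Der Ax Δ A → Der Ax (B ∷ Δ) A
  wkHyp = weaken Any.there

  hyp₀ : ∀ {Ax : Axioms} {Γ} {Δ : List (Form Γ)} {A} → Der Ax (A ∷ Δ) A
  hyp₀ = hyp (Any.here refl)

  cast : ∀ {Ax : Axioms} {Γ} {Δ : List (Form Γ)} {A B} → A ≡ B → Der Ax Δ A → Der Ax Δ B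
  cast refl d = d

  castHyps : ∀ {Ax : Axioms} {Γ} {Δ Δ' : List (Form Γ)} {A} → Δ ≡ Δ' → Der Ax Δ A → Der Ax Δ' A
  castHyps refl d = d

  map-comm : ∀ {A B C E : Set} {f : B → E} {g : A → B} {h : C → E} {k : A → C}
           → (∀ x → f (g x) ≡ h (k x)) → ∀ xs → map f (map g xs) ≡ map h (map k xs)
  map-comm e xs = trans (sym (map-∘ xs)) (trans (map-cong e xs) (map-∘ xs))

  map-identity : ∀ {A : Set} {f : A → A} → (∀ x → f x ≡ x) → ∀ xs → map f xs ≡ xs
  map-identity e xs = trans (map-cong e xs) (map-id xs)

  ILAx-subF : ∀ {Γ Θ} {A : Form Γ} (s : Subst Γ Θ) → ILAx A → ILAx (subF s A)
  ILAx-subF s (eq-refl x) = eq-refl _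
  ILAx-subF s (eq-subst A a x y) =
    subst ILAx (sym (cong₂ (λ P Q → imp (and (eq (subT s x) (subT s y)) P) Q) (subF-[] s x A) (subF-[] s y A)))
      (eq-subst (subF (liftS s) A) (Atomic-subF (liftS s) a) (subT s x) (subT s y))
  ILAx-subF s (ball-def₁ {σ = σ} t A) =
    subst (λ z → ILAx (imp (ball σ (subT s t) (subF (liftS s) A)) (all σ (imp (mem (var here) z) (subF (liftS s) A)))))
      (sym (subT-liftS-wkT s t)) (ball-def₁ (subT s t) (subF (liftS s) A))
  ILAx-subF s (ball-def₂ {σ = σ} t A) =
    subst (λ z → ILAx (imp (all σ (imp (mem (var here) z) (subF (liftS s) A))) (ball σ (subT s t) (subF (liftS s) A))))
      (sym (subT-liftS-wkT s t)) (ball-def₂ (subT s t) (subF (liftS s) A))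
  ILAx-subF s (bex-def₁ {σ = σ} t A) =
    subst (λ z → ILAx (imp (bex σ (subT s t) (subF (liftS s) A)) (ex σ (and (mem (var here) z) (subF (liftS s) A)))))
      (sym (subT-liftS-wkT s t)) (bex-def₁ (subT s t) (subF (liftS s) A))
  ILAx-subF s (bex-def₂ {σ = σ} t A) =
    subst (λ z → ILAx (imp (ex σ (and (mem (var here) z) (subF (liftS s) A))) (bex σ (subT s t) (subF (liftS s) A))))
      (sym (subT-liftS-wkT s t)) (bex-def₂ (subT s t) (subF (liftS s) A))
  ILAx-subF s (Σ-ax x y z)        = Σ-ax _ _ _
  ILAx-subF s (Π-ax x y)          = Π-ax _ _
  ILAx-subF s (sng-ax₁ w x)       = sng-ax₁ _ _
  ILAx-subF s (sng-ax₂ w x)       = sng-ax₂ _ _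
  ILAx-subF s (cup-ax₁ w x y)     = cup-ax₁ _ _ _
  ILAx-subF s (cup-ax₂ w x y)     = cup-ax₂ _ _ _
  ILAx-subF s (bigcup-ax z x w y) = bigcup-ax _ _ _ _
  ILAx-subF s (bigcup-sng x y)    = bigcup-sng _ _
  ILAx-subF s (bigcup-cup x y z)  = bigcup-cup _ _ _

  TAx-subF : ∀ {Γ Θ} (T : Axioms) {A : Form Γ} (s : Subst Γ Θ) → TAx T A → TAx T (subF s A)
  TAx-subF T s (Γ₀ , B , B∈T , s' , refl) = Γ₀ , B , B∈T , subT s ∘ s' , subF-subF s s' B

  module Derived (Ax : Axioms) (IL⊆Ax : ∀ {Γ} {A : Form Γ} → ILAx A → Ax A)
                 (Ax-subF : ∀ {Γ Θ} {A : Form Γ} (s : Subst Γ Θ) → Ax A → Ax (subF s A)) where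

    D : ∀ {Γ} → List (Form Γ) → Form Γ → Set
    D = Der Ax

    il : ∀ {Γ} {Δ : List (Form Γ)} {A} → ILAx A → D Δ A
    il a = ax (IL⊆Ax a)

    Der-subF : ∀ {Γ Θ} {Δ : List (Form Γ)} {A} (s : Subst Γ Θ) → D Δ A → D (map (subF s) Δ) (subF s A)
    Der-subF s (hyp m)     = hyp (∈-map⁺ (subF s) m)
    Der-subF s (ax a)      = ax (Ax-subF s a)
    Der-subF s (⊥E d)      = ⊥E (Der-subF s d)
    Der-subF s (∧I d e)    = ∧I (Der-subF s d) (Der-subF s e)
    Der-subF s (∧E₁ d)     = ∧E₁ (Der-subF s d)
    Der-subF s (∧E₂ d)     = ∧E₂ (Der-subF s d)
    Der-subF s (∨I₁ d)     = ∨I₁ (Der-subF s d)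
    Der-subF s (∨I₂ d)     = ∨I₂ (Der-subF s d)
    Der-subF s (∨E d e f)  = ∨E (Der-subF s d) (Der-subF s e) (Der-subF s f)
    Der-subF s (→I d)      = →I (Der-subF s d)
    Der-subF s (→E d e)    = →E (Der-subF s d) (Der-subF s e)
    Der-subF {Δ = Δ} s (∀I d) = ∀I (castHyps (map-comm (subF-liftS-wkF s) Δ) (Der-subF (liftS s) d))
    Der-subF s (∀E {A = A} d t) = cast (sym (subF-[] s t A)) (∀E (Der-subF s d) (subT s t))
    Der-subF s (∃I {A = A} t d) = ∃I (subT s t) (cast (subF-[] s t A) (Der-subF s d))
    Der-subF {Δ = Δ} s (∃E {C = C} d e) =
      ∃E (Der-subF s d) (cast (subF-liftS-wkF s C)
                              (castHyps (cong (_ ∷_) (map-comm (subF-liftS-wkF s) Δ)) (Der-subF (liftS s) e)))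

    Der-renF : ∀ {Γ Θ} {Δ : List (Form Γ)} {A} (r : Ren Γ Θ) → D Δ A → D (map (renF r) Δ) (renF r A)
    Der-renF {Δ = Δ} {A} r d =
      cast (sym (renF≡subF r A)) (castHyps (map-cong (sym ∘ renF≡subF r) Δ) (Der-subF (ren r) d))

    Der-wkF : ∀ {Γ σ} {Δ : List (Form Γ)} {A} → D Δ A → D (map (wkF {τ = σ}) Δ) (wkF A)
    Der-wkF = Der-renF there

    ∀-open : ∀ {Γ σ} {Δ : List (Form Γ)} {A} → D Δ (all σ A) → D (map wkF Δ) A
    ∀-open {A = A} d = cast (liftR-there-[here] A) (∀E (Der-wkF d) (var here))

    allN-open : ∀ {Θ} (xs : List Ty) {Δ : List (Form Θ)} {A} → D Δ (allN xs A) → D (map (renF (inr xs)) Δ) A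
    allN-open []       {Δ} d = castHyps (sym (map-identity (renF-identity λ _ → refl) Δ)) d
    allN-open (σ ∷ xs) {Δ} d =
      castHyps (trans (sym (map-∘ Δ)) (map-cong (renF-renF there (inr xs)) Δ)) (∀-open (allN-open xs d))

    allN-I : ∀ {Θ} (xs : List Ty) {Δ : List (Form Θ)} {A} → D (map (renF (inr xs)) Δ) A → D Δ (allN xs A)
    allN-I []       {Δ} d = castHyps (map-identity (renF-identity λ _ → refl) Δ) d
    allN-I (σ ∷ xs) {Δ} d =
      allN-I xs (∀I (castHyps (trans (sym (map-cong (renF-renF there (inr xs)) Δ)) (map-∘ Δ)) d))

    allN-E : ∀ {Θ} (xs : List Ty) {Δ : List (Form Θ)} {A} → D Δ (allN xs A) → (args : Subst xs Θ)
           → D Δ (subF (extS xs args var) A)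
    allN-E xs {Δ} d args =
      castHyps (trans (sym (map-∘ Δ)) (map-identity cancel Δ)) (Der-subF (extS xs args var) (allN-open xs d))
      where
      cancel : ∀ H → subF (extS xs args var) (renF (inr xs) H) ≡ H
      cancel H = trans (subF-renF _ _ H) (subF-identity (extS-inr xs args var) H)

    ball-open : ∀ {Γ σ} {Δ : List (Form Γ)} {t : Term Γ (σ *)} {A}
              → D Δ (ball σ t A) → D (map wkF Δ) (imp (mem (var here) (wkT t)) A)
    ball-open {t = t} {A} d = ∀-open (→E (il (ball-def₁ t A)) d)

    ball-I : ∀ {Γ σ} {Δ : List (Form Γ)} {t : Term Γ (σ *)} {A}
           → D (mem (var here) (wkT t) ∷ map wkF Δ) A → D Δ (ball σ t A)
    ball-I {t = t} {A} d = →E (il (ball-def₂ t A)) (∀I (→I d))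

    bex-I : ∀ {Γ σ} {Δ : List (Form Γ)} {t : Term Γ (σ *)} {A} (u : Term Γ σ)
          → D Δ (mem u t) → D Δ (A [ u ]) → D Δ (bex σ t A)
    bex-I {t = t} {A} u m d = →E (il (bex-def₂ t A)) (∃I u (∧I (cast (cong (mem u) (sym (sub1-wkT u t))) m) d))

    bex-E : ∀ {Γ σ} {Δ : List (Form Γ)} {t : Term Γ (σ *)} {A} {C}
          → D Δ (bex σ t A) → D (A ∷ mem (var here) (wkT t) ∷ map wkF Δ) (wkF C) → D Δ C
    bex-E {t = t} {A} d e =
      ∃E (→E (il (bex-def₁ t A)) d) (→E (→E (wkHyp (→I (→I e))) (∧E₁ hyp₀)) (∧E₂ hyp₀))

    infix 4 _⊢_≐_

    _⊢_≐_ : ∀ {Γ ρ} → List (Form Γ) → Term Γ ρ → Term Γ ρ → Set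
    Δ ⊢ x ≐ y = D Δ (eq x y)

    infix 4 _⊢ˢ_≐_

    _⊢ˢ_≐_ : ∀ {Γ Θ} → List (Form Θ) → Subst Γ Θ → Subst Γ Θ → Set
    _⊢ˢ_≐_ {Γ} Δ s₁ s₂ = ∀ {σ} (v : Var Γ σ) → Δ ⊢ s₁ v ≐ s₂ v

    ≐-refl : ∀ {Γ ρ} {Δ : List (Form Γ)} (t : Term Γ ρ) → Δ ⊢ t ≐ t
    ≐-refl t = il (eq-refl t)

    ≐-subst₁ : ∀ {Γ ρ} {Δ : List (Form Γ)} (A : Form (ρ ∷ Γ)) → Atomic A → {x y : Term Γ ρ}
             → Δ ⊢ x ≐ y → D Δ (A [ x ]) → D Δ (A [ y ])
    ≐-subst₁ A a {x} {y} e d = →E (il (eq-subst A a x y)) (∧I e d)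

    ≐-sym : ∀ {Γ ρ} {Δ : List (Form Γ)} {x y : Term Γ ρ} → Δ ⊢ x ≐ y → Δ ⊢ y ≐ x
    ≐-sym {x = x} {y} e = cast (cong (eq y) (sub1-wkT y x))
      (≐-subst₁ (eq (var here) (wkT x)) (at-eq _ _) e (cast (cong (eq x) (sym (sub1-wkT x x))) (≐-refl x)))

    ≐-trans : ∀ {Γ ρ} {Δ : List (Form Γ)} {x y z : Term Γ ρ} → Δ ⊢ x ≐ y → Δ ⊢ y ≐ z → Δ ⊢ x ≐ z
    ≐-trans {x = x} {y} {z} e₁ e₂ = cast (cong (λ w → eq w z) (sub1-wkT z x))
      (≐-subst₁ (eq (wkT x) (var here)) (at-eq _ _) e₂ (cast (cong (λ w → eq w y) (sym (sub1-wkT y x))) e₁))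

    mem-resp-≐ : ∀ {Γ ρ} {Δ : List (Form Γ)} {u : Term Γ ρ} {a b}
               → D Δ (mem u a) → Δ ⊢ a ≐ b → D Δ (mem u b)
    mem-resp-≐ {u = u} {a} {b} m e = cast (cong (λ w → mem w b) (sub1-wkT b u))
      (≐-subst₁ (mem (wkT u) (var here)) (at-mem _ _) e (cast (cong (λ w → mem w a) (sym (sub1-wkT a u))) m))

    -- Only rewriting a single variable is an axiom; rewrite the variables of xs one at a time.
    ≐-substs : ∀ {Θ} (xs : List Ty) {Δ : List (Form Θ)} (F : Form (xs ++ Θ)) → Atomic F → (a b : Subst xs Θ)
             → Δ ⊢ˢ a ≐ b → D Δ (subF (extS xs a var) F) → D Δ (subF (extS xs b var) F)
    ≐-substs []       F at a b e d = d
    ≐-substs {Θ} (σ ∷ xs) F at a b e d =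
      cast (trans (via-plug (b ∘ there)) (sym (split-head b)))
        (≐-substs xs (subF plug F) (Atomic-subF plug at) (a ∘ there) (b ∘ there) (e ∘ there)
          (cast (trans (via-sub1 (b here)) (sym (via-plug (a ∘ there))))
            (≐-subst₁ F₁ (Atomic-subF _ at) (e here)
              (cast (trans (split-head a) (sym (via-sub1 (a here)))) d))))
      where
      F₁ : Form (σ ∷ Θ)
      F₁ = subF (liftS (extS xs (a ∘ there) var)) F
      plug : Subst (σ ∷ xs ++ Θ) (xs ++ Θ)
      plug = renT (inr xs) (b here) ∷ˢ var
      via-sub1 : (u : Term Θ σ) → F₁ [ u ] ≡ subF (extS (σ ∷ xs) (u ∷ˢ a ∘ there) var) F
      via-sub1 u = trans (subF-subF _ _ F) (subF-cong (sub1-liftS-extS xs u (a ∘ there)) F)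
      via-plug : (c : Subst xs Θ) → subF (extS xs c var) (subF plug F) ≡ subF (extS (σ ∷ xs) (b here ∷ˢ c) var) F
      via-plug c = trans (subF-subF _ _ F) (subF-cong (extS-plug xs (b here) c) F)
      split-head : (c : Subst (σ ∷ xs) Θ)
                 → subF (extS (σ ∷ xs) c var) F ≡ subF (extS (σ ∷ xs) (c here ∷ˢ c ∘ there) var) F
      split-head c = subF-cong (extS-cong (σ ∷ xs) {ρ = var} {ρ' = var} head∷tail λ _ → refl) F
        where
        head∷tail : c ≗ˢ c here ∷ˢ c ∘ there
        head∷tail here      = refl
        head∷tail (there _) = refl

    ≐-cong : ∀ {Γ Θ τ} {Δ : List (Form Θ)} (t : Term Γ τ) {s₁ s₂ : Subst Γ Θ}
           → Δ ⊢ˢ s₁ ≐ s₂ → Δ ⊢ subT s₁ t ≐ subT s₂ t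
    ≐-cong {Γ} {Θ} t {s₁} {s₂} e =
      cast (at s₂) (≐-substs Γ F (at-eq _ _) s₁ s₂ e (cast (sym (at s₁)) (≐-refl _)))
      where
      F = eq (renT (inr Γ) (subT s₁ t)) (renT (inl Γ) t)
      at : (s : Subst Γ Θ) → subF (extS Γ s var) F ≡ eq (subT s₁ t) (subT s t)
      at s = cong₂ eq (trans (subT-renT _ _ (subT s₁ t)) (subT-identity (extS-inr Γ s var) (subT s₁ t)))
                      (trans (subT-renT _ _ t) (subT-cong (extS-inl Γ s var) t))

    ≐-subst-atomic : ∀ {Γ Θ} {Δ : List (Form Θ)} (F : Form Γ) → Atomic F → {s₁ s₂ : Subst Γ Θ}
                   → Δ ⊢ˢ s₁ ≐ s₂ → D Δ (subF s₁ F) → D Δ (subF s₂ F)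
    ≐-subst-atomic {Γ} {Θ} F at {s₁} {s₂} e d =
      cast (via s₂) (≐-substs Γ (renF (inl Γ) F) (Atomic-renF at) s₁ s₂ e (cast (sym (via s₁)) d))
      where
      via : (s : Subst Γ Θ) → subF (extS Γ s var) (renF (inl Γ) F) ≡ subF s F
      via s = trans (subF-renF _ _ F) (subF-cong (extS-inl Γ s var) F)
      Atomic-renF : ∀ {F : Form Γ} → Atomic F → Atomic (renF (inl Γ) F)
      Atomic-renF at-⊥          = at-⊥
      Atomic-renF (at-eq t u)   = at-eq _ _
      Atomic-renF (at-mem t u)  = at-mem _ _
      Atomic-renF (at-rel R ts) = at-rel R _

    ≐-liftS : ∀ {Γ Θ σ} {Δ : List (Form Θ)} {s₁ s₂ : Subst Γ Θ}
            → Δ ⊢ˢ s₁ ≐ s₂ → map wkF Δ ⊢ˢ liftS {σ = σ} s₁ ≐ liftS s₂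
    ≐-liftS e here      = ≐-refl _
    ≐-liftS e (there v) = Der-wkF (e v)

    ≐-subst : ∀ {Γ Θ} {Δ : List (Form Θ)} (F : Form Γ) {s₁ s₂ : Subst Γ Θ}
            → Δ ⊢ˢ s₁ ≐ s₂ → D Δ (subF s₁ F) → D Δ (subF s₂ F)
    ≐-subst ⊥'         e d = ≐-subst-atomic ⊥' at-⊥ e d
    ≐-subst (eq t u)   e d = ≐-subst-atomic _ (at-eq t u) e d
    ≐-subst (mem t u)  e d = ≐-subst-atomic _ (at-mem t u) e d
    ≐-subst (rel R ts) e d = ≐-subst-atomic _ (at-rel R ts) e d
    ≐-subst (or A B)   e d = ∨E d (∨I₁ (≐-subst A (wkHyp ∘ e) hyp₀)) (∨I₂ (≐-subst B (wkHyp ∘ e) hyp₀))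
    ≐-subst (and A B)  e d = ∧I (≐-subst A e (∧E₁ d)) (≐-subst B e (∧E₂ d))
    ≐-subst (imp A B)  e d = →I (≐-subst B (wkHyp ∘ e) (→E (wkHyp d) (≐-subst A (wkHyp ∘ ≐-sym ∘ e) hyp₀)))
    ≐-subst (all σ A)  e d = ∀I (≐-subst A (≐-liftS e) (∀-open d))
    ≐-subst (ex σ A)   e d =
      ∃E d (∃I (var here) (cast (sym (liftR-there-[here] _)) (≐-subst A (wkHyp ∘ ≐-liftS e) hyp₀)))
    ≐-subst (ball σ t A) e d =
      ball-I (≐-subst A (wkHyp ∘ ≐-liftS e)
                      (→E (wkHyp (ball-open d)) (mem-resp-≐ hyp₀ (wkHyp (Der-wkF (≐-sym (≐-cong t e)))))))
    ≐-subst (bex σ t A) e d =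
      bex-E d (bex-I (var here) (mem-resp-≐ (wkHyp hyp₀) (wkHyp (wkHyp (Der-wkF (≐-cong t e)))))
                     (cast (sym (liftR-there-[here] _)) (≐-subst A (wkHyp ∘ wkHyp ∘ ≐-liftS e) hyp₀)))

    ≐-rewrite : ∀ {Θ ρ} {Δ : List (Form Θ)} (F : Form (ρ ∷ Θ)) {x y : Term Θ ρ}
              → Δ ⊢ x ≐ y → D Δ (F [ x ]) → D Δ (F [ y ])
    ≐-rewrite F {x} {y} e = ≐-subst F pt
      where
      pt : _ ⊢ˢ sub1 x ≐ sub1 y
      pt here      = e
      pt (there v) = ≐-refl _

    ≐-app : ∀ {Θ σ τ} {Δ : List (Form Θ)} {f f' : Term Θ (σ ⇒ τ)} {a a'}
          → Δ ⊢ f ≐ f' → Δ ⊢ a ≐ a' → Δ ⊢ app f a ≐ app f' a'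
    ≐-app {f = f} {f'} {a} {a'} e₁ e₂ =
      ≐-cong (app (var here) (var (there here))) {f ∷ˢ a ∷ˢ var} {f' ∷ˢ a' ∷ˢ var} pt
      where
      pt : _ ⊢ˢ f ∷ˢ a ∷ˢ var ≐ f' ∷ˢ a' ∷ˢ var
      pt here              = e₁
      pt (there here)      = e₂
      pt (there (there v)) = ≐-refl _

    ≐-applyAll : ∀ {Θ τ} {Δ : List (Form Θ)} (xs : List Ty) {f g : Term Θ (arrows xs τ)} (args : Subst xs Θ)
               → Δ ⊢ f ≐ g → Δ ⊢ applyAll xs f args ≐ applyAll xs g args
    ≐-applyAll []       args e = e
    ≐-applyAll (σ ∷ xs) args e = ≐-applyAll xs (args ∘ there) (≐-app e (≐-refl _))

    lam-β : ∀ {Γ Θ σ τ} {Δ : List (Form Θ)} (t : Term (σ ∷ Γ) τ) (ρ : Subst Γ Θ) (u : Term Θ σ)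
          → Δ ⊢ app (subT ρ (lam t)) u ≐ subT (u ∷ˢ ρ) t
    lam-β (var here)      ρ u = ≐-trans (il (Σ-ax _ _ u)) (il (Π-ax u _))
    lam-β (var (there v)) ρ u = il (Π-ax _ u)
    lam-β (con c)         ρ u = il (Π-ax _ u)
    lam-β (app t t')      ρ u = ≐-trans (il (Σ-ax _ _ u)) (≐-app (lam-β t ρ u) (lam-β t' ρ u))

    lam-β-here : ∀ {Θ σ τ} {Δ : List (Form (σ ∷ Θ))} (t : Term (σ ∷ Θ) τ)
               → Δ ⊢ app (wkT (lam t)) (var here) ≐ t
    lam-β-here t = cast (cong₂ (λ x y → eq (app x (var here)) y) (sym (renT≡subT there (lam t))) (subT-identity pt t))
                        (lam-β t (var ∘ there) (var here))
      where
      pt : var here ∷ˢ var ∘ there ≗ˢ var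
      pt here      = refl
      pt (there v) = refl

    lams-β : ∀ {Δ Θ τ} {Hs : List (Form Θ)} (xs : List Ty) (t : Term (xs ++ Δ) τ) (ρ : Subst Δ Θ) (args : Subst xs Θ)
           → Hs ⊢ applyAll xs (subT ρ (lams xs t)) args ≐ subT (extS xs args ρ) t
    lams-β []       t ρ args = cast (cong (eq _) (subT-cong (λ _ → refl) t)) (≐-refl _)
    lams-β (σ ∷ xs) t ρ args =
      ≐-trans (≐-applyAll xs (args ∘ there) (lam-β (lams xs (renT (swapR xs) t)) ρ (args here)))
              (cast (cong (eq _) (trans (subT-renT _ _ t) (subT-cong pt t)))
                    (lams-β xs (renT (swapR xs) t) (args here ∷ˢ ρ) (args ∘ there)))
      where
      pt : extS xs (args ∘ there) (args here ∷ˢ ρ) ∘ swapR xs ≗ˢ extS (σ ∷ xs) args ρ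
      pt here = extS-inr xs (args ∘ there) (args here ∷ˢ ρ) here
      pt (there v) with split xs v
      ... | inj₁ x = extS-inl xs (args ∘ there) (args here ∷ˢ ρ) x
      ... | inj₂ g = extS-inr xs (args ∘ there) (args here ∷ˢ ρ) (there g)

    Incl-wkF : ∀ {Θ σ} {Δ : List (Form Θ)} {τ} {a b : Term Θ τ}
             → D Δ (Incl τ a b) → D (map (wkF {τ = σ}) Δ) (Incl τ (wkT a) (wkT b))
    Incl-wkF {τ = τ} {a} {b} d = cast (renF-Incl there τ a b) (Der-wkF d)

    Incl-renF : ∀ {Θ Θ'} {Δ : List (Form Θ)} (r : Ren Θ Θ') {τ} {a b : Term Θ τ}
              → D Δ (Incl τ a b) → D (map (renF r) Δ) (Incl τ (renT r a) (renT r b))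
    Incl-renF r {τ} {a} {b} d = cast (renF-Incl r τ a b) (Der-renF r d)

    Incl-app : ∀ {Θ σ τ} {Δ : List (Form Θ)} {f g : Term Θ (σ ⇒ τ)}
             → D Δ (Incl (σ ⇒ τ) f g) → (u : Term Θ σ) → D Δ (Incl τ (app f u) (app g u))
    Incl-app {τ = τ} {f = f} {g} d u =
      cast (trans (subF-Incl (sub1 u) τ _ _) (cong₂ (λ x y → Incl τ (app x u) (app y u)) (sub1-wkT u f) (sub1-wkT u g)))
           (∀E d u)

    Incl-applyAll : ∀ {Θ τ} {Δ : List (Form Θ)} (xs : List Ty) {f g : Term Θ (arrows xs τ)}
                  → D Δ (Incl (arrows xs τ) f g) → (args : Subst xs Θ)
                  → D Δ (Incl τ (applyAll xs f args) (applyAll xs g args))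
    Incl-applyAll []       d args = d
    Incl-applyAll (σ ∷ xs) d args = Incl-applyAll xs (Incl-app d (args here)) (args ∘ there)

    Incl-mem : ∀ {Θ σ} {Δ : List (Form Θ)} {a b : Term Θ (σ *)} {u}
             → D Δ (Incl (σ *) a b) → D Δ (mem u a) → D Δ (mem u b)
    Incl-mem {a = a} {b} {u} d =
      →E (cast (cong₂ (λ x y → imp (mem u x) (mem u y)) (sub1-wkT u a) (sub1-wkT u b)) (∀E d u))

    Incl-respʳ-≐ : ∀ {Θ} {Δ : List (Form Θ)} {τ} {a b b' : Term Θ τ}
                 → D Δ (Incl τ a b) → Δ ⊢ b ≐ b' → D Δ (Incl τ a b')
    Incl-respʳ-≐ {τ = τ} {a} {b} {b'} d e = cast (at b') (≐-rewrite (Incl τ (wkT a) (var here)) e (cast (sym (at b)) d))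
      where
      at : ∀ c → Incl τ (wkT a) (var here) [ c ] ≡ Incl τ a c
      at c = trans (subF-Incl (sub1 c) τ _ _) (cong (λ x → Incl τ x c) (sub1-wkT c a))

    Incl-respˡ-≐ : ∀ {Θ} {Δ : List (Form Θ)} {τ} {a a' b : Term Θ τ}
                 → Δ ⊢ a ≐ a' → D Δ (Incl τ a b) → D Δ (Incl τ a' b)
    Incl-respˡ-≐ {τ = τ} {a} {a'} {b} e d = cast (at a') (≐-rewrite (Incl τ (var here) (wkT b)) e (cast (sym (at a)) d))
      where
      at : ∀ c → Incl τ (var here) (wkT b) [ c ] ≡ Incl τ c b
      at c = trans (subF-Incl (sub1 c) τ _ _) (cong (Incl τ c) (sub1-wkT c b))

    Incl-unionˡ : ∀ {Θ} (τ : Ty) (p : EndsInStar τ) {Δ : List (Form Θ)} (a b : Term Θ τ)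
                → D Δ (Incl τ a (union τ p a b))
    Incl-unionˡ G       () a b
    Incl-unionˡ (σ ⇒ τ) p  f g = ∀I (Incl-respʳ-≐ (Incl-unionˡ τ p _ _) (≐-sym (lam-β-here _)))
    Incl-unionˡ (σ *)   p  a b = ∀I (→I (→E (il (cup-ax₂ (var here) (wkT a) (wkT b))) (∨I₁ hyp₀)))

    Incl-unionʳ : ∀ {Θ} (τ : Ty) (p : EndsInStar τ) {Δ : List (Form Θ)} (a b : Term Θ τ)
                → D Δ (Incl τ b (union τ p a b))
    Incl-unionʳ G       () a b
    Incl-unionʳ (σ ⇒ τ) p  f g = ∀I (Incl-respʳ-≐ (Incl-unionʳ τ p _ _) (≐-sym (lam-β-here _)))
    Incl-unionʳ (σ *)   p  a b = ∀I (→I (→E (il (cup-ax₂ (var here) (wkT a) (wkT b))) (∨I₂ hyp₀)))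

    Incl-bigUnion : ∀ {Θ σ} (τ : Ty) (p : EndsInStar τ) {Δ : List (Form Θ)} (Z : Term Θ (σ *)) (f : Term Θ (σ ⇒ τ))
                    (z : Term Θ σ) → D Δ (mem z Z) → D Δ (Incl τ (app f z) (bigUnion τ p Z f))
    Incl-bigUnion G () Z f z m
    Incl-bigUnion (ρ *) p Z f z m =
      ∀I (→I (→E (il (bigcup-ax (wkT z) (wkT Z) (var here) (wkT f))) (∧I (wkHyp (Der-wkF m)) hyp₀)))
    Incl-bigUnion {Θ} {σ} (ρ ⇒ τ) p Z f z m =
      ∀I (Incl-respʳ-≐ (Incl-respˡ-≐ β-inner (Incl-bigUnion τ p (wkT Z) (lam inner) (wkT z) (Der-wkF m)))
                       (≐-sym (lam-β-here _)))
      where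
      inner : Term (σ ∷ ρ ∷ Θ) τ
      inner = app (app (wkT (wkT f)) (var here)) (var (there here))
      β-inner : ∀ {Δ'} → Δ' ⊢ app (lam inner) (wkT z) ≐ app (app (wkT f) (wkT z)) (var here)
      β-inner = cast (cong₂ (λ x y → eq (app x (wkT z)) (app (app y (wkT z)) (var here)))
                            (subT-var (lam inner)) (trans (subT-renT _ there (wkT f)) (subT-var (wkT f))))
                     (lam-β inner var (wkT z))

    infix 4 _⊢ʷ_⊑_

    _⊢ʷ_⊑_ : ∀ {xs Θ} → List (Form Θ) → Subst xs Θ → Subst xs Θ → Set
    _⊢ʷ_⊑_ {xs} Δ ws ws' = ∀ {τ} (x : Var xs τ) → D Δ (Incl τ (ws x) (ws' x))

    inst-mono : ∀ {Γ Θ} (A : Form Γ) (ρ : Subst Γ Θ) {Δ : List (Form Θ)} {ws ws' : Subst (W A) Θ}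
              → Δ ⊢ʷ ws ⊑ ws' → D Δ (inst (hr A) ρ ws) → D Δ (inst (hr A) ρ ws')
    inst-mono ⊥'         ρ h d = d
    inst-mono (eq t u)   ρ h d = d
    inst-mono (mem t u)  ρ h d = d
    inst-mono (rel R ts) ρ h d = d
    inst-mono (or A B) ρ {ws = ws} {ws'} h d = cast (sym (inst-or (hr A) (hr B) ρ ws'))
      (∨E (cast (inst-or (hr A) (hr B) ρ ws) d)
          (∨I₁ (inst-mono A ρ (wkHyp ∘ h ∘ inl (W A)) hyp₀))
          (∨I₂ (inst-mono B ρ (wkHyp ∘ h ∘ inr (W A)) hyp₀)))
    inst-mono (and A B) ρ {ws = ws} {ws'} h d = cast (sym (inst-and (hr A) (hr B) ρ ws'))
      (∧I (inst-mono A ρ (h ∘ inl (W A)) (∧E₁ d'))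
          (inst-mono B ρ (h ∘ inr (W A)) (∧E₂ d')))
      where d' = cast (inst-and (hr A) (hr B) ρ ws) d
    inst-mono (imp A B) ρ {ws = U} {U'} h d = cast (sym (inst-imp (hr A) (hr B) ρ U'))
      (allN-I (W A) (→I (inst-mono B (wkS (W A) ρ)
        (λ y → wkHyp (Incl-applyAll (W A) (Incl-renF (inr (W A)) (h (mapVar (arrows (W A)) y))) _))
        (→E (wkHyp (allN-open (W A) (cast (inst-imp (hr A) (hr B) ρ U) d))) hyp₀))))
    inst-mono (all σ A) ρ {ws = ws} {ws'} h d = cast (sym (inst-all σ (hr A) ρ ws'))
      (∀I (inst-mono A (liftS ρ) (λ x → ∀-open (h (mapVar (σ ⇒_) x))) (∀-open (cast (inst-all σ (hr A) ρ ws) d))))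
    inst-mono (ex σ A) ρ {ws = ws} {ws'} h d = cast (sym (inst-ex σ (hr A) ρ ws'))
      (bex-E (cast (inst-ex σ (hr A) ρ ws) d)
        (bex-I (var here) (Incl-mem (wkHyp (wkHyp (Incl-wkF {τ = σ *} (h here)))) (wkHyp hyp₀))
          (cast (sym (liftR-there-[here] _)) (inst-mono A (liftS ρ) (wkHyp ∘ wkHyp ∘ Incl-wkF ∘ h ∘ there) hyp₀))))
    inst-mono (ball σ t A) ρ {ws = ws} {ws'} h d = cast (sym (inst-ball σ t (hr A) ρ ws'))
      (ball-I (inst-mono A (liftS ρ) (wkHyp ∘ Incl-wkF ∘ h)
        (→E (wkHyp (ball-open (cast (inst-ball σ t (hr A) ρ ws) d))) hyp₀)))
    inst-mono (bex σ t A) ρ {ws = ws} {ws'} h d = cast (sym (inst-bex σ t (hr A) ρ ws'))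
      (bex-E (cast (inst-bex σ t (hr A) ρ ws) d)
        (bex-I (var here) (wkHyp hyp₀)
          (cast (sym (liftR-there-[here] _)) (inst-mono A (liftS ρ) (wkHyp ∘ wkHyp ∘ Incl-wkF ∘ h) hyp₀))))

    -- Realizers

    Realized : ∀ {Γ Θ} → HForm Γ → Subst Γ Θ → List (Form Θ) → Set
    Realized {Θ = Θ} X ρ Hs = Σ (Subst (proj₁ X) Θ) λ ws → D Hs (inst X ρ ws)

    Realized-≡ : ∀ {Γ Θ} {X Y : HForm Γ} {ρ : Subst Γ Θ} {Hs} → X ≡ Y → Realized Y ρ Hs → Realized X ρ Hs
    Realized-≡ refl r = r

    Realized-cong : ∀ {Γ Θ} (X : HForm Γ) {ρ ρ' : Subst Γ Θ} {Hs}
                  → ρ ≗ˢ ρ' → Realized X ρ Hs → Realized X ρ' Hs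
    Realized-cong X e (ws , d) = ws , cast (inst-cong X e λ _ → refl) d

    Realized-wkHyp : ∀ {Γ Θ} {X : HForm Γ} {ρ : Subst Γ Θ} {Hs H} → Realized X ρ Hs → Realized X ρ (H ∷ Hs)
    Realized-wkHyp (ws , d) = ws , wkHyp d

    Realized-renF : ∀ {Γ Θ Θ'} (X : HForm Γ) {ρ : Subst Γ Θ} {Hs} (r : Ren Θ Θ')
                  → Realized X ρ Hs → Realized X (renT r ∘ ρ) (map (renF r) Hs)
    Realized-renF X {ρ} r (ws , d) = renT r ∘ ws , cast (renF-inst X r ρ ws) (Der-renF r d)

    Realized-subF : ∀ {Γ Δ Θ} (A : Form Γ) (s : Subst Γ Δ) {ρ : Subst Δ Θ} {Hs}
                  → Realized (hr A) (subT ρ ∘ s) Hs → Realized (hr (subF s A)) ρ Hs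
    Realized-subF A s {ρ} (ws , d) = Realized-≡ (hr-subF s A) (ws , cast (sym (inst-subH (hr A) s ρ ws)) d)

    Realized-subF⁻ : ∀ {Γ Δ Θ} (A : Form Γ) (s : Subst Γ Δ) {ρ : Subst Δ Θ} {Hs}
                   → Realized (hr (subF s A)) ρ Hs → Realized (hr A) (subT ρ ∘ s) Hs
    Realized-subF⁻ A s {ρ} r with Realized-≡ (sym (hr-subF s A)) r
    ... | ws , d = ws , cast (inst-subH (hr A) s ρ ws) d

    Realized-wkF : ∀ {Γ Θ σ} (A : Form Γ) {ρ : Subst (σ ∷ Γ) Θ} {Hs}
                 → Realized (hr A) (ρ ∘ there) Hs → Realized (hr (wkF A)) ρ Hs
    Realized-wkF A r = Realized-≡ (cong hr (renF≡subF there A)) (Realized-subF A (var ∘ there) r)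

    Realized-wkF⁻ : ∀ {Γ Θ σ} (A : Form Γ) {ρ : Subst (σ ∷ Γ) Θ} {Hs}
                  → Realized (hr (wkF A)) ρ Hs → Realized (hr A) (ρ ∘ there) Hs
    Realized-wkF⁻ A r = Realized-subF⁻ A (var ∘ there) (Realized-≡ (sym (cong hr (renF≡subF there A))) r)

    inst-≐ : ∀ {Γ Θ} (X : HForm Γ) (ρ : Subst Γ Θ) {Hs} {ws ws' : Subst (proj₁ X) Θ}
           → Hs ⊢ˢ ws ≐ ws' → D Hs (inst X ρ ws) → D Hs (inst X ρ ws')
    inst-≐ (xs , F) ρ {ws = ws} {ws'} e = ≐-subst F pt
      where
      pt : _ ⊢ˢ extS xs ws ρ ≐ extS xs ws' ρ
      pt v with split xs v
      ... | inj₁ x = e x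
      ... | inj₂ g = ≐-refl _

    tabulateMap : ∀ {Θ} (f : Ty → Ty) (xs : List Ty) → (∀ {τ} → Var xs τ → Term Θ (f τ)) → Subst (map f xs) Θ
    tabulateMap f (x ∷ xs) g here      = g here
    tabulateMap f (x ∷ xs) g (there v) = tabulateMap f xs (g ∘ there) v

    tabulateMap-mapVar : ∀ {Θ} (f : Ty → Ty) (xs : List Ty) (g : ∀ {τ} → Var xs τ → Term Θ (f τ))
                         {τ} (x : Var xs τ)
                       → tabulateMap f xs g (mapVar f x) ≡ g x
    tabulateMap-mapVar f (y ∷ xs) g here      = refl
    tabulateMap-mapVar f (y ∷ xs) g (there x) = tabulateMap-mapVar f xs (g ∘ there) x

    realize-→I : ∀ {Γ Θ} (X Y : HForm Γ) (ρ : Subst Γ Θ) (Hs : List (Form Θ))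
               → let xs = proj₁ X in
                 Realized Y (wkS xs ρ) (inst X (wkS xs ρ) (fresh xs) ∷ map (renF (inr xs)) Hs)
               → Realized (impH X Y) ρ Hs
    realize-→I {Θ = Θ} X@(xs , _) Y@(ys , _) ρ Hs (wsY , d) =
      U , cast (sym (inst-imp X Y ρ U)) (allN-I xs (→I (inst-≐ Y _ (≐-sym ∘ applyFresh-U) d)))
      where
      U : Subst (map (arrows xs) ys) Θ
      U = tabulateMap (arrows xs) ys (lams xs ∘ wsY)
      applyFresh-U : ∀ {τ} (y : Var ys τ) → _ ⊢ applyFresh xs (U (mapVar (arrows xs) y)) ≐ wsY y
      applyFresh-U y =
        cast (cong₂ (λ a b → eq (applyAll xs a (fresh xs)) b)
                    (trans (sym (renT≡subT (inr xs) _)) (cong (renT (inr xs)) (sym (tabulateMap-mapVar (arrows xs) ys _ y))))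
                    (subT-identity (extS-var xs) (wsY y)))
             (lams-β xs (wsY y) (var ∘ inr xs) (fresh xs))

    inst-→E : ∀ {Γ Θ} (X Y : HForm Γ) (ρ : Subst Γ Θ) {Hs : List (Form Θ)} (U : Subst (proj₁ (impH X Y)) Θ)
            → D Hs (inst (impH X Y) ρ U) → (args : Subst (proj₁ X) Θ) → D Hs (inst X ρ args)
            → D Hs (inst Y ρ (λ y → applyAll (proj₁ X) (U (mapVar (arrows (proj₁ X)) y)) args))
    inst-→E X@(xs , _) Y@(ys , _) ρ U d args da =
      cast (trans (subF-inst Y _ _ _) (inst-cong Y cancel cancel-U))
           (→E (allN-E xs (cast (inst-imp X Y ρ U) d) args)
               (cast (sym (trans (subF-inst X _ _ _) (inst-cong X cancel (extS-inl xs args var)))) da))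
      where
      cancel : subT (extS xs args var) ∘ renT (inr xs) ∘ ρ ≗ˢ ρ
      cancel v = trans (subT-renT _ _ (ρ v)) (subT-identity (extS-inr xs args var) (ρ v))
      cancel-U : ∀ {τ} (y : Var ys τ) → subT (extS xs args var) (applyFresh xs (U (mapVar (arrows xs) y)))
                                        ≡ applyAll xs (U (mapVar (arrows xs) y)) args
      cancel-U y = trans (subT-applyAll xs _ _ _)
                         (applyAll-cong xs (trans (subT-renT (extS xs args var) (inr xs) (U (mapVar (arrows xs) y)))
                                                  (subT-identity (extS-inr xs args var) (U (mapVar (arrows xs) y))))
                                           (extS-inl xs args var))

    realize-→I₀ : ∀ {Γ Θ} (F : Form Γ) (Y : HForm Γ) (ρ : Subst Γ Θ) (Hs : List (Form Θ))
                → Realized Y ρ (subF ρ F ∷ Hs) → Realized (impH ([] , F) Y) ρ Hs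
    realize-→I₀ F Y ρ Hs r = realize-→I ([] , F) Y ρ Hs
      (subst (Realized Y (wkS [] ρ)) (cong₂ _∷_ (subF-cong (sym ∘ renT-identity (λ _ → refl) ∘ ρ) F)
                                       (sym (map-identity (renF-identity λ _ → refl) Hs)))
        (Realized-cong Y (sym ∘ renT-identity (λ _ → refl) ∘ ρ) r))

    inst-→E₀ : ∀ {Γ Θ} (F : Form Γ) (Y : HForm Γ) (ρ : Subst Γ Θ) {Hs : List (Form Θ)}
               (U : Subst (proj₁ (impH ([] , F) Y)) Θ)
             → D Hs (inst (impH ([] , F) Y) ρ U) → D Hs (subF ρ F) → D Hs (inst Y ρ (U ∘ mapVar (arrows [])))
    inst-→E₀ F Y ρ U d dF = inst-→E ([] , F) Y ρ U d (λ ()) (cast (sym (inst-atomic F ρ λ ())) dF)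

    realize-∀I : ∀ {Γ Θ} σ (X : HForm (σ ∷ Γ)) (ρ : Subst Γ Θ) (Hs : List (Form Θ))
               → Realized X (liftS ρ) (map wkF Hs) → Realized (allH σ X) ρ Hs
    realize-∀I {Θ = Θ} σ X@(xs , _) ρ Hs (ws , d) =
      Ws , cast (sym (inst-all σ X ρ Ws)) (∀I (inst-≐ X (liftS ρ) Ws-here d))
      where
      Ws : Subst (map (σ ⇒_) xs) Θ
      Ws = tabulateMap (σ ⇒_) xs (lam ∘ ws)
      Ws-here : _ ⊢ˢ ws ≐ (λ x → app (wkT (Ws (mapVar (σ ⇒_) x))) (var here))
      Ws-here x = cast (cong (λ z → eq (ws x) (app (wkT z) (var here))) (sym (tabulateMap-mapVar (σ ⇒_) xs _ x)))
                       (≐-sym (lam-β-here (ws x)))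

    inst-∀E : ∀ {Γ Θ} σ (X : HForm (σ ∷ Γ)) (ρ : Subst Γ Θ) {Hs : List (Form Θ)}
              (ws : Subst (proj₁ (allH σ X)) Θ)
            → D Hs (inst (allH σ X) ρ ws) → (u : Term Θ σ)
            → D Hs (inst X (u ∷ˢ ρ) (λ x → app (ws (mapVar (σ ⇒_) x)) u))
    inst-∀E σ X ρ ws d u =
      cast (trans (subF-inst X (sub1 u) (liftS ρ) _) (inst-cong X pt (λ x → cong (λ z → app z u) (sub1-wkT u _))))
           (∀E (cast (inst-all σ X ρ ws) d) u)
      where
      pt : subT (sub1 u) ∘ liftS ρ ≗ˢ u ∷ˢ ρ
      pt here      = refl
      pt (there v) = sub1-wkT u (ρ v)

    mem-sng : ∀ {Θ σ} {Hs : List (Form Θ)} (u : Term Θ σ) → D Hs (mem u (app (con (sng σ)) u))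
    mem-sng u = →E (il (sng-ax₂ u u)) (≐-refl u)

    realize-∃I : ∀ {Γ Θ} σ (X : HForm (σ ∷ Γ)) (ρ : Subst Γ Θ) {Hs : List (Form Θ)}
                 (u : Term Θ σ) (Z : Term Θ (σ *))
               → D Hs (mem u Z) → Realized X (u ∷ˢ ρ) Hs → Realized (exH σ X) ρ Hs
    realize-∃I σ X ρ u Z m (ws , d) = Z ∷ˢ ws , cast (sym (inst-ex σ X ρ (Z ∷ˢ ws)))
      (bex-I u m (cast (sym (trans (subF-inst X (sub1 u) (liftS ρ) _) (inst-cong X pt (sub1-wkT u ∘ ws)))) d))
      where
      pt : subT (sub1 u) ∘ liftS ρ ≗ˢ u ∷ˢ ρ
      pt here      = refl
      pt (there v) = sub1-wkT u (ρ v)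

    realize-∃free : ∀ {Γ Θ} {A : Form Γ} → ExFree A → Ax A
                  → (ρ : Subst Γ Θ) (Hs : List (Form Θ)) → Realized (hr A) ρ Hs
    realize-∃free {A = A} ef a ρ Hs =
      Realized-≡ (hr-∃free ef) ((λ ()) , cast (sym (inst-atomic A ρ λ ())) (ax (Ax-subF ρ a)))

    realize-ball-def₁ : ∀ {Γ Θ σ} (t : Term Γ (σ *)) (A : Form (σ ∷ Γ)) (ρ : Subst Γ Θ) (Hs : List (Form Θ))
                      → Realized (hr (imp (ball σ t A) (all σ (imp (mem (var here) (wkT t)) A)))) ρ Hs
    realize-ball-def₁ {σ = σ} t A ρ Hs =
      realize-→I XB Y ρ Hs (realize-∀I σ (impH ([] , M) (hr A)) ρ₁ Hs₁
        (realize-→I₀ M (hr A) (liftS ρ₁) (map wkF Hs₁) (wkT ∘ fresh xs , body)))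
      where
      xs = W A
      M = mem (var here) (wkT t)
      XB = ballH σ t (hr A)
      Y = allH σ (impH ([] , M) (hr A))
      ρ₁ = wkS xs ρ
      Hs₁ = inst XB ρ₁ (fresh xs) ∷ map (renF (inr xs)) Hs
      body : D (subF (liftS ρ₁) M ∷ map wkF Hs₁) (inst (hr A) (liftS ρ₁) (wkT ∘ fresh xs))
      body = →E (wkHyp (ball-open (cast (inst-ball σ t (hr A) ρ₁ (fresh xs)) hyp₀)))
                (cast (cong (mem (var here)) (subT-liftS-wkT ρ₁ t)) hyp₀)

    -- Realizing ∀x(x ∈ t → A) → ∀x ∈ t A needs witnesses independent of x: the union over x ∈ t.
    realize-ball-def₂ : ∀ {Γ Θ σ} (t : Term Γ (σ *)) (A : Form (σ ∷ Γ)) (ρ : Subst Γ Θ) (Hs : List (Form Θ))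
                      → Realized (hr (imp (all σ (imp (mem (var here) (wkT t)) A)) (ball σ t A))) ρ Hs
    realize-ball-def₂ {Θ = Θ} {σ} t A ρ Hs =
      realize-→I XI (ballH σ t (hr A)) ρ Hs (ws , cast (sym (inst-ball σ t (hr A) ρ₁ ws)) (ball-I body))
      where
      xs = W A
      M = mem (var here) (wkT t)
      XI = allH σ (impH ([] , M) (hr A))
      xs₁ = proj₁ XI
      ρ₁ = wkS xs₁ ρ
      Hs₁ = inst XI ρ₁ (fresh xs₁) ∷ map (renF (inr xs₁)) Hs
      fx : ∀ {τ} → Var xs τ → Term (xs₁ ++ Θ) (σ ⇒ τ)
      fx = fresh xs₁ ∘ mapVar (σ ⇒_) ∘ mapVar (arrows [])
      ws : Subst xs (xs₁ ++ Θ)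
      ws {τ} x = bigUnion τ (W-endsInStar A x) (subT ρ₁ t) (fx x)
      fx⊑ws : mem (var here) (wkT (subT ρ₁ t)) ∷ map wkF Hs₁ ⊢ʷ (λ x → app (wkT (fx x)) (var here)) ⊑ wkT ∘ ws
      fx⊑ws {τ} x = cast (cong (Incl τ _) (sym (renT-bigUnion τ (W-endsInStar A x) there (subT ρ₁ t) (fx x))))
                         (Incl-bigUnion τ (W-endsInStar A x) (wkT (subT ρ₁ t)) (wkT (fx x)) (var here) hyp₀)
      body : D (mem (var here) (wkT (subT ρ₁ t)) ∷ map wkF Hs₁) (inst (hr A) (liftS ρ₁) (wkT ∘ ws))
      body = inst-mono A (liftS ρ₁) fx⊑ws
               (inst-→E₀ M (hr A) (liftS ρ₁) (λ y → app (wkT (fresh xs₁ (mapVar (σ ⇒_) y))) (var here))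
                 (wkHyp (∀-open (cast (inst-all σ (impH ([] , M) (hr A)) ρ₁ (fresh xs₁)) hyp₀)))
                 (cast (sym (cong (mem (var here)) (subT-liftS-wkT ρ₁ t))) hyp₀))

    realize-bex-def₁ : ∀ {Γ Θ σ} (t : Term Γ (σ *)) (A : Form (σ ∷ Γ)) (ρ : Subst Γ Θ) (Hs : List (Form Θ))
                     → Realized (hr (imp (bex σ t A) (ex σ (and (mem (var here) (wkT t)) A)))) ρ Hs
    realize-bex-def₁ {Θ = Θ} {σ} t A ρ Hs = realize-→I XB (exH σ (andH ([] , M) (hr A))) ρ Hs (ws , body)
      where
      xs = W A
      M = mem (var here) (wkT t)
      XB = bexH σ t (hr A)
      ρ₁ = wkS xs ρ
      Hs₁ = inst XB ρ₁ (fresh xs) ∷ map (renF (inr xs)) Hs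
      ws : Subst (σ * ∷ xs) (xs ++ Θ)
      ws = subT ρ₁ t ∷ˢ fresh xs
      M-inst : inst ([] , M) (liftS ρ₁) (λ ()) ≡ mem (var here) (wkT (subT ρ₁ t))
      M-inst = trans (inst-atomic M (liftS ρ₁) λ ()) (cong (mem (var here)) (subT-liftS-wkT ρ₁ t))
      Matrix = inst (andH ([] , M) (hr A)) (liftS ρ₁) (wkT ∘ ws ∘ there)
      matrix : D (inst (hr A) (liftS ρ₁) (wkT ∘ fresh xs) ∷ mem (var here) (wkT (subT ρ₁ t)) ∷ map wkF Hs₁) Matrix
      matrix = cast (sym (inst-and ([] , M) (hr A) (liftS ρ₁) (wkT ∘ ws ∘ there)))
                    (∧I (cast (sym M-inst) (wkHyp hyp₀)) hyp₀)
      body : D Hs₁ (inst (exH σ (andH ([] , M) (hr A))) ρ₁ ws)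
      body = cast (sym (inst-ex σ (andH ([] , M) (hr A)) ρ₁ ws))
                  (bex-E (cast (inst-bex σ t (hr A) ρ₁ (fresh xs)) hyp₀)
                         (bex-I (var here) (wkHyp hyp₀) (cast (sym (liftR-there-[here] Matrix)) matrix)))

    realize-bex-def₂ : ∀ {Γ Θ σ} (t : Term Γ (σ *)) (A : Form (σ ∷ Γ)) (ρ : Subst Γ Θ) (Hs : List (Form Θ))
                     → Realized (hr (imp (ex σ (and (mem (var here) (wkT t)) A)) (bex σ t A))) ρ Hs
    realize-bex-def₂ {Θ = Θ} {σ} t A ρ Hs = realize-→I XI (bexH σ t (hr A)) ρ Hs (ws , body)
      where
      xs = W A
      M = mem (var here) (wkT t)
      XI = exH σ (andH ([] , M) (hr A))
      xs₁ = σ * ∷ xs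
      ρ₁ = wkS xs₁ ρ
      Hs₁ = inst XI ρ₁ (fresh xs₁) ∷ map (renF (inr xs₁)) Hs
      ws : Subst xs (xs₁ ++ Θ)
      ws = fresh xs₁ ∘ there
      M-inst : inst ([] , M) (liftS ρ₁) (λ ()) ≡ mem (var here) (wkT (subT ρ₁ t))
      M-inst = trans (inst-atomic M (liftS ρ₁) λ ()) (cong (mem (var here)) (subT-liftS-wkT ρ₁ t))
      Hs₂ = inst (andH ([] , M) (hr A)) (liftS ρ₁) (wkT ∘ ws) ∷ mem (var here) (wkT (fresh xs₁ here)) ∷ map wkF Hs₁
      M∧A : D Hs₂ (and (inst ([] , M) (liftS ρ₁) λ ()) (inst (hr A) (liftS ρ₁) (wkT ∘ ws)))
      M∧A = cast (inst-and ([] , M) (hr A) (liftS ρ₁) _) hyp₀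
      body : D Hs₁ (inst (bexH σ t (hr A)) ρ₁ ws)
      body = cast (sym (inst-bex σ t (hr A) ρ₁ ws))
                  (bex-E (cast (inst-ex σ (andH ([] , M) (hr A)) ρ₁ (fresh xs₁)) hyp₀)
                         (bex-I (var here) (cast M-inst (∧E₁ M∧A)) (cast (sym (liftR-there-[here] _)) (∧E₂ M∧A))))

    -- The witness of ∀x ∃y A is already a set-valued choice function, so it is the realizer of ∃f.
    realize-AC : ∀ {Γ Θ} (κ σ : Ty) (A : Form (σ ∷ κ ∷ Γ)) (ρ : Subst Γ Θ) (Hs : List (Form Θ))
               → Realized (hr (imp (all κ (ex σ A))
                                   (ex (κ ⇒ σ *) (all κ (bex σ (app (var (there here)) (var here))
                                                              (renF (liftR (liftR there)) A)))))) ρ Hs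
    realize-AC {Γ} {Θ} κ σ A ρ Hs =
      Realized-≡ (cong (λ Z → impH XI (exH (κ ⇒ σ *) (allH κ (bexH σ f·x Z))))
                       (trans (cong hr (renF≡subF r A)) (hr-subF (ren r) A)))
        (realize-→I XI Y ρ Hs (realize-∃I (κ ⇒ σ *) Y₀ ρ₁ f (app (con (sng _)) f) (mem-sng f)
                                            (fresh xs₁ ∘ there , body)))
      where
      r : Ren (σ ∷ κ ∷ Γ) (σ ∷ κ ∷ (κ ⇒ σ *) ∷ Γ)
      r = liftR (liftR there)
      f·x : Term (κ ∷ (κ ⇒ σ *) ∷ Γ) (σ *)
      f·x = app (var (there here)) (var here)
      XI = allH κ (exH σ (hr A))
      Y₀ = allH κ (bexH σ f·x (subH (ren r) (hr A)))
      Y = exH (κ ⇒ σ *) Y₀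
      xs₁ = proj₁ XI
      ρ₁ = wkS xs₁ ρ
      f = fresh xs₁ here
      Hs₁ = inst XI ρ₁ (fresh xs₁) ∷ map (renF (inr xs₁)) Hs
      ρ₂ = f ∷ˢ ρ₁
      ws : Subst (W A) (σ ∷ κ ∷ xs₁ ++ Θ)
      ws x = wkT (app (wkT (fresh xs₁ (there (mapVar (κ ⇒_) x)))) (var here))
      Common = all κ (bex σ (app (wkT f) (var here)) (inst (hr A) (liftS (liftS ρ₁)) ws))
      premise : inst XI ρ₁ (fresh xs₁) ≡ Common
      premise = trans (inst-all κ (exH σ (hr A)) ρ₁ (fresh xs₁)) (cong (all κ) (inst-ex σ (hr A) (liftS ρ₁) _))
      pt : subT (liftS (liftS ρ₂)) ∘ ren r ≗ˢ liftS (liftS ρ₁)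
      pt here              = refl
      pt (there here)      = refl
      pt (there (there g)) = refl
      conclusion : inst Y₀ ρ₂ (fresh xs₁ ∘ there) ≡ Common
      conclusion = trans (inst-all κ (bexH σ f·x (subH (ren r) (hr A))) ρ₂ _)
                         (cong (all κ) (trans (inst-bex σ f·x (subH (ren r) (hr A)) (liftS ρ₂) _)
                                              (cong (bex σ _) (trans (inst-subH (hr A) _ (liftS (liftS ρ₂)) _)
                                                                     (inst-cong (hr A) pt λ _ → refl)))))
      body : D Hs₁ (inst Y₀ ρ₂ (fresh xs₁ ∘ there))
      body = cast (sym conclusion) (cast premise hyp₀)

    -- B is ∃-free, hence its own realizability: it has no witnesses on which those of ∃y A could depend.
    realize-IP : ∀ {Γ Θ} (B : Form Γ) → ExFree B → (σ : Ty) (A : Form (σ ∷ Γ))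
                 (ρ : Subst Γ Θ) (Hs : List (Form Θ))
               → Realized (hr (imp (imp B (ex σ A))
                                   (ex (σ *) (imp (wkF B) (bex σ (var here) (renF (liftR there) A)))))) ρ Hs
    realize-IP {Θ = Θ} B ef σ A ρ Hs =
      Realized-≡ (trans (cong (λ Z → impH (impH Z (exH σ (hr A)))
                                          (exH (σ *) (impH (hr (wkF B)) (bexH σ (var here) (hr (renF (liftR there) A))))))
                              (hr-∃free ef))
                        (cong₂ (λ Z₁ Z₂ → impH XI (exH (σ *) (impH Z₁ (bexH σ (var here) Z₂))))
                               (hr-∃free wkB-∃free) (trans (cong hr (renF≡subF (liftR there) A)) (hr-subF _ A))))
        (realize-→I XI Y ρ Hs
          (realize-∃I (σ *) Y₁ ρ₁ w (app (con (sng _)) w) (mem-sng w)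
            (realize-→I₀ (wkF B) (bexH σ (var here) A′) ρ₂ Hs₁
              (ws , cast (sym conclusion) (cast (inst-ex σ (hr A) ρ₁ (fresh xs₁ ∘ mapVar (arrows []))) premise)))))
      where
      wkB-∃free : ExFree (wkF B)
      wkB-∃free = subst ExFree (sym (renF≡subF there B)) (ExFree-subF (var ∘ there) ef)
      A′ = subH (ren (liftR there)) (hr A)
      XI = impH ([] , B) (exH σ (hr A))
      Y₁ = impH ([] , wkF B) (bexH σ (var here) A′)
      Y = exH (σ *) Y₁
      xs₁ = proj₁ XI
      ρ₁ = wkS xs₁ ρ
      w = fresh xs₁ here
      Hs₁ = inst XI ρ₁ (fresh xs₁) ∷ map (renF (inr xs₁)) Hs
      ρ₂ = w ∷ˢ ρ₁
      ws : Subst (W A) (xs₁ ++ Θ)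
      ws = fresh xs₁ ∘ mapVar (arrows []) ∘ there
      premise : D (subF ρ₂ (wkF B) ∷ Hs₁) (inst (exH σ (hr A)) ρ₁ (fresh xs₁ ∘ mapVar (arrows [])))
      premise = inst-→E₀ B (exH σ (hr A)) ρ₁ (fresh xs₁) (wkHyp hyp₀) (cast (subF-renF ρ₂ there B) hyp₀)
      pt : subT (liftS ρ₂) ∘ ren (liftR there) ≗ˢ liftS ρ₁
      pt here      = refl
      pt (there g) = refl
      conclusion : inst (bexH σ (var here) A′) ρ₂ ws ≡ bex σ w (inst (hr A) (liftS ρ₁) (wkT ∘ ws))
      conclusion = trans (inst-bex σ (var here) A′ ρ₂ ws)
                         (cong (bex σ w) (trans (inst-subH (hr A) _ (liftS ρ₂) _) (inst-cong (hr A) pt λ _ → refl)))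

    realize-IL : ∀ {Γ Θ} {A : Form Γ} → ILAx A → (ρ : Subst Γ Θ) (Hs : List (Form Θ)) → Realized (hr A) ρ Hs
    realize-IL a@(eq-refl x)          = realize-∃free (ef-at (at-eq _ _)) (IL⊆Ax a)
    realize-IL a@(eq-subst A at x y)  = realize-∃free (ef-imp (ef-and (ef-at (at-eq _ _)) (ef-at (Atomic-subF _ at)))
                                                              (ef-at (Atomic-subF _ at))) (IL⊆Ax a)
    realize-IL (ball-def₁ t A)        = realize-ball-def₁ t A
    realize-IL (ball-def₂ t A)        = realize-ball-def₂ t A
    realize-IL (bex-def₁ t A)         = realize-bex-def₁ t A
    realize-IL (bex-def₂ t A)         = realize-bex-def₂ t A
    realize-IL a@(Σ-ax x y z)         = realize-∃free (ef-at (at-eq _ _)) (IL⊆Ax a)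
    realize-IL a@(Π-ax x y)           = realize-∃free (ef-at (at-eq _ _)) (IL⊆Ax a)
    realize-IL a@(sng-ax₁ w x)        = realize-∃free (ef-imp (ef-at (at-mem _ _)) (ef-at (at-eq _ _))) (IL⊆Ax a)
    realize-IL a@(sng-ax₂ w x)        = realize-∃free (ef-imp (ef-at (at-eq _ _)) (ef-at (at-mem _ _))) (IL⊆Ax a)
    realize-IL a@(cup-ax₁ w x y)      =
      realize-∃free (ef-imp (ef-at (at-mem _ _)) (ef-or (ef-at (at-mem _ _)) (ef-at (at-mem _ _)))) (IL⊆Ax a)
    realize-IL a@(cup-ax₂ w x y)      =
      realize-∃free (ef-imp (ef-or (ef-at (at-mem _ _)) (ef-at (at-mem _ _))) (ef-at (at-mem _ _))) (IL⊆Ax a)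
    realize-IL a@(bigcup-ax z x w y)  =
      realize-∃free (ef-imp (ef-and (ef-at (at-mem _ _)) (ef-at (at-mem _ _))) (ef-at (at-mem _ _))) (IL⊆Ax a)
    realize-IL a@(bigcup-sng x y)     = realize-∃free (ef-at (at-eq _ _)) (IL⊆Ax a)
    realize-IL a@(bigcup-cup x y z)   = realize-∃free (ef-at (at-eq _ _)) (IL⊆Ax a)

    realize-∧I : ∀ {Γ Θ} (X Y : HForm Γ) {ρ : Subst Γ Θ} {Hs}
               → Realized X ρ Hs → Realized Y ρ Hs → Realized (andH X Y) ρ Hs
    realize-∧I X@(xs , _) Y {ρ} (ws₁ , d₁) (ws₂ , d₂) = extS xs ws₁ ws₂ , cast (sym (inst-and X Y ρ _))
      (∧I (cast (inst-cong X (λ _ → refl) (sym ∘ extS-inl xs ws₁ ws₂)) d₁)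
          (cast (inst-cong Y (λ _ → refl) (sym ∘ extS-inr xs ws₁ ws₂)) d₂))

    realize-∧E₁ : ∀ {Γ Θ} (X Y : HForm Γ) {ρ : Subst Γ Θ} {Hs} → Realized (andH X Y) ρ Hs → Realized X ρ Hs
    realize-∧E₁ X Y {ρ} (ws , d) = _ , ∧E₁ (cast (inst-and X Y ρ ws) d)

    realize-∧E₂ : ∀ {Γ Θ} (X Y : HForm Γ) {ρ : Subst Γ Θ} {Hs} → Realized (andH X Y) ρ Hs → Realized Y ρ Hs
    realize-∧E₂ X Y {ρ} (ws , d) = _ , ∧E₂ (cast (inst-and X Y ρ ws) d)

    realize-∨I₁ : ∀ {Γ Θ} (X Y : HForm Γ) {ρ : Subst Γ Θ} {Hs} → Realized X ρ Hs → Realized (orH X Y) ρ Hs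
    realize-∨I₁ X@(xs , _) Y {ρ} (ws , d) = extS xs ws (λ {τ} _ → inhabitant τ) , cast (sym (inst-or X Y ρ _))
      (∨I₁ (cast (inst-cong X (λ _ → refl) (sym ∘ extS-inl xs ws (λ {τ} _ → inhabitant τ))) d))

    realize-∨I₂ : ∀ {Γ Θ} (X Y : HForm Γ) {ρ : Subst Γ Θ} {Hs} → Realized Y ρ Hs → Realized (orH X Y) ρ Hs
    realize-∨I₂ X@(xs , _) Y {ρ} (ws , d) = extS xs (λ {τ} _ → inhabitant τ) ws , cast (sym (inst-or X Y ρ _))
      (∨I₂ (cast (inst-cong Y (λ _ → refl) (sym ∘ extS-inr xs (λ {τ} _ → inhabitant τ) ws)) d))

    realize-∨E : ∀ {Γ Θ} (X Y : HForm Γ) (C : Form Γ) {ρ : Subst Γ Θ} {Hs}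
                 (w : Subst (proj₁ X ++ proj₁ Y) Θ) → D Hs (inst (orH X Y) ρ w)
               → Realized (hr C) ρ (inst X ρ (w ∘ inl (proj₁ X)) ∷ Hs)
               → Realized (hr C) ρ (inst Y ρ (w ∘ inr (proj₁ X)) ∷ Hs)
               → Realized (hr C) ρ Hs
    realize-∨E X Y C {ρ} w d (c₁ , d₁) (c₂ , d₂) =
      c , ∨E (cast (inst-or X Y ρ w) d)
             (inst-mono C ρ (λ {τ} x → Incl-unionˡ τ (W-endsInStar C x) (c₁ x) (c₂ x)) d₁)
             (inst-mono C ρ (λ {τ} x → Incl-unionʳ τ (W-endsInStar C x) (c₁ x) (c₂ x)) d₂)
      where
      c : Subst (W C) _
      c {τ} x = union τ (W-endsInStar C x) (c₁ x) (c₂ x)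

    -- The witnesses for C may depend on the element y ∈ Z picked from the ∃-witness Z; take their union over Z.
    realize-∃E : ∀ {Γ Θ σ} (X : HForm (σ ∷ Γ)) (C : Form Γ) {ρ : Subst Γ Θ} {Hs}
                 (w : Subst (proj₁ (exH σ X)) Θ) → D Hs (inst (exH σ X) ρ w)
               → Realized (hr C) (wkT ∘ ρ)
                          (inst X (liftS ρ) (wkT ∘ w ∘ there) ∷ mem (var here) (wkT (w here)) ∷ map wkF Hs)
               → Realized (hr C) ρ Hs
    realize-∃E {Θ = Θ} {σ} X C {ρ} w d (c , dc) =
      c′ , bex-E (cast (inst-ex σ X ρ w) d) (cast (sym (renF-inst (hr C) there ρ c′)) (inst-mono C (wkT ∘ ρ) c⊑c′ dc))
      where
      c′ : Subst (W C) Θ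
      c′ {τ} x = bigUnion τ (W-endsInStar C x) (w here) (lam (c x))
      c⊑c′ : _ ⊢ʷ c ⊑ wkT ∘ c′
      c⊑c′ {τ} x = cast (cong (Incl τ (c x)) (sym (renT-bigUnion τ (W-endsInStar C x) there (w here) (lam (c x)))))
                        (Incl-respˡ-≐ (lam-β-here (c x))
                                      (Incl-bigUnion τ (W-endsInStar C x) (wkT (w here)) (wkT (lam (c x))) (var here)
                                                     (wkHyp hyp₀)))

    close-β : ∀ {Γ τ} {Hs : List (Form Γ)} (t : Term Γ τ) (r : Ren [] Γ)
            → Hs ⊢ applyAll Γ (renT r (close Γ t)) var ≐ t
    close-β {Γ} t r =
      cast (cong₂ eq (cong (λ z → applyAll Γ z var) (sym (trans (renT≡subT r (close Γ t)) (subT-cong (λ ()) (close Γ t)))))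
                     (trans (subT-renT (extS Γ var none) (inl Γ) t) (subT-identity (extS-inl Γ var none) t)))
           (lams-β Γ (renT (inl Γ) t) none var)
      where
      none : Subst [] Γ
      none ()

    closed-witnesses : ∀ {Γ} (A : Form Γ) → Realized (hr A) var []
                     → Σ (∀ τ → Var (W A) τ → Term [] (arrows Γ τ)) λ ts → D [] (subF (instW (W A) ts) (HR A))
    closed-witnesses {Γ} A (ws , d) = (λ _ → close Γ ∘ ws) , ≐-subst (HR A) pt d
      where
      pt : [] ⊢ˢ extS (W A) ws var ≐ instW (W A) (λ _ → close Γ ∘ ws)
      pt v with split (W A) v
      ... | inj₁ x = ≐-sym (close-β (ws x) _)
      ... | inj₂ g = ≐-refl _

  -- Soundness

  IL+T-subF : (T : Axioms) → ∀ {Γ Θ} {A : Form Γ} (s : Subst Γ Θ)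
            → (ILAx ∪A TAx T) A → (ILAx ∪A TAx T) (subF s A)
  IL+T-subF T s (inj₁ a) = inj₁ (ILAx-subF s a)
  IL+T-subF T s (inj₂ a) = inj₂ (TAx-subF T s a)

  module Soundness (T : Axioms) (T-∃free : ∀ {Γ} (B : Form Γ) → T B → ExFree B) where
    open Derived (ILAx ∪A TAx T) inj₁ (IL+T-subF T) public

    realize-axiom : ∀ {Γ Θ} {A : Form Γ} → (ILAx ∪A (ACAx ∪A (IPAx ∪A TAx T))) A
                  → (ρ : Subst Γ Θ) (Hs : List (Form Θ)) → Realized (hr A) ρ Hs
    realize-axiom (inj₁ a)                           = realize-IL a
    realize-axiom (inj₂ (inj₁ (ac κ σ A)))           = realize-AC κ σ A
    realize-axiom (inj₂ (inj₂ (inj₁ (ip B ef σ A)))) = realize-IP B ef σ A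
    realize-axiom (inj₂ (inj₂ (inj₂ t@(_ , B , B∈T , s , refl)))) =
      realize-∃free (ExFree-subF s (T-∃free B B∈T)) (inj₂ t)

    RealizedHyps : ∀ {Γ Θ} → List (Form Γ) → Subst Γ Θ → List (Form Θ) → Set
    RealizedHyps Δ ρ Hs = ∀ {A} → A ∈ Δ → Realized (hr A) ρ Hs

    RealizedHyps-∷ : ∀ {Γ Θ} {Δ : List (Form Γ)} {ρ : Subst Γ Θ} {Hs} {A} (ws : Subst (W A) Θ)
                   → RealizedHyps Δ ρ Hs → RealizedHyps (A ∷ Δ) ρ (inst (hr A) ρ ws ∷ Hs)
    RealizedHyps-∷ ws ok (Any.here refl) = ws , hyp₀
    RealizedHyps-∷ ws ok (Any.there m)   = Realized-wkHyp (ok m)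

    RealizedHyps-wkHyp : ∀ {Γ Θ} {Δ : List (Form Γ)} {ρ : Subst Γ Θ} {Hs} {H}
                       → RealizedHyps Δ ρ Hs → RealizedHyps Δ ρ (H ∷ Hs)
    RealizedHyps-wkHyp ok = Realized-wkHyp ∘ ok

    RealizedHyps-renF : ∀ {Γ Θ Θ'} {Δ : List (Form Γ)} {ρ : Subst Γ Θ} {Hs} (r : Ren Θ Θ')
                      → RealizedHyps Δ ρ Hs → RealizedHyps Δ (renT r ∘ ρ) (map (renF r) Hs)
    RealizedHyps-renF r ok {A} = Realized-renF (hr A) r ∘ ok

    RealizedHyps-wkF : ∀ {Γ Θ σ} {Δ : List (Form Γ)} {ρ : Subst Γ Θ} {Hs}
                     → RealizedHyps Δ ρ Hs → RealizedHyps (map (wkF {τ = σ}) Δ) (liftS ρ) (map wkF Hs)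
    RealizedHyps-wkF ok m with ∈-map⁻ wkF m
    ... | A , m′ , refl = Realized-wkF A (Realized-renF (hr A) there (ok m′))

    soundness : ∀ {Γ} {Δ : List (Form Γ)} {A} → Der (ILAx ∪A (ACAx ∪A (IPAx ∪A TAx T))) Δ A
              → ∀ {Θ} (ρ : Subst Γ Θ) (Hs : List (Form Θ)) → RealizedHyps Δ ρ Hs → Realized (hr A) ρ Hs
    soundness (hyp m)  ρ Hs ok = ok m
    soundness (ax a)   ρ Hs ok = realize-axiom a ρ Hs
    soundness (⊥E d)   ρ Hs ok = (λ {τ} _ → inhabitant τ) , ⊥E (proj₂ (soundness d ρ Hs ok))
    soundness (∧I {A = A} {B} d e) ρ Hs ok = realize-∧I (hr A) (hr B) (soundness d ρ Hs ok) (soundness e ρ Hs ok)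
    soundness (∧E₁ {A = A} {B} d)  ρ Hs ok = realize-∧E₁ (hr A) (hr B) (soundness d ρ Hs ok)
    soundness (∧E₂ {A = A} {B} d)  ρ Hs ok = realize-∧E₂ (hr A) (hr B) (soundness d ρ Hs ok)
    soundness (∨I₁ {A = A} {B} d)  ρ Hs ok = realize-∨I₁ (hr A) (hr B) (soundness d ρ Hs ok)
    soundness (∨I₂ {A = A} {B} d)  ρ Hs ok = realize-∨I₂ (hr A) (hr B) (soundness d ρ Hs ok)
    soundness (∨E {A = A} {B} {C} d e f) ρ Hs ok with soundness d ρ Hs ok
    ... | w , dw = realize-∨E (hr A) (hr B) C w dw (soundness e ρ _ (RealizedHyps-∷ _ ok))
                                                  (soundness f ρ _ (RealizedHyps-∷ _ ok))
    soundness (→I {A = A} {B} d) ρ Hs ok =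
      realize-→I (hr A) (hr B) ρ Hs (soundness d _ _ (RealizedHyps-∷ (fresh (W A)) (RealizedHyps-renF (inr (W A)) ok)))
    soundness (→E {A = A} {B} d e) ρ Hs ok with soundness d ρ Hs ok | soundness e ρ Hs ok
    ... | U , dU | a , da = _ , inst-→E (hr A) (hr B) ρ U dU a da
    soundness (∀I {σ = σ} {A = A} d) ρ Hs ok =
      realize-∀I σ (hr A) ρ Hs (soundness d (liftS ρ) (map wkF Hs) (RealizedHyps-wkF ok))
    soundness (∀E {σ = σ} {A = A} d t) ρ Hs ok with soundness d ρ Hs ok
    ... | w , dw = Realized-subF A (sub1 t) (Realized-cong (hr A) sub1-subT (_ , inst-∀E σ (hr A) ρ w dw (subT ρ t)))
      where
      sub1-subT : subT ρ t ∷ˢ ρ ≗ˢ subT ρ ∘ sub1 t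
      sub1-subT here      = refl
      sub1-subT (there v) = refl
    soundness (∃I {σ = σ} {A = A} t d) ρ Hs ok =
      realize-∃I σ (hr A) ρ (subT ρ t) _ (mem-sng (subT ρ t))
                 (Realized-cong (hr A) subT-sub1 (Realized-subF⁻ A (sub1 t) (soundness d ρ Hs ok)))
      where
      subT-sub1 : subT ρ ∘ sub1 t ≗ˢ subT ρ t ∷ˢ ρ
      subT-sub1 here      = refl
      subT-sub1 (there v) = refl
    soundness (∃E {A = A} {C} d e) ρ Hs ok with soundness d ρ Hs ok
    ... | w , dw = realize-∃E (hr A) C w dw
                     (Realized-wkF⁻ C (soundness e (liftS ρ) _
                       (RealizedHyps-∷ (wkT ∘ w ∘ there) (RealizedHyps-wkHyp (RealizedHyps-wkF ok)))))

theorem6 : (L : Language) → let open Syntax L in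
    (T : Axioms) → (∀ {Γ} (B : Form Γ) → T B → ExFree B) →
    (Γ : List Ty) (A : Form Γ) →
    Der (ILAx ∪A (ACAx ∪A (IPAx ∪A TAx T))) [] A →
    Σ (∀ τ → Var (W A) τ → Term [] (arrows Γ τ)) λ ts →
      Der (ILAx ∪A TAx T) [] (subF (instW (W A) ts) (HR A))
theorem6 L T T-∃free Γ A d = closed-witnesses A (soundness d var [] λ ())
  where
  open Syntax L
  open Realizability L
  open Soundness T T-∃free
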